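{- For every $n\ge 3$, the number of alternating permutations $\sigma\in A_n$ satisfying $\sigma_3-\sigma_1\ge 2$ equals $n!$ times the coefficient of $x^n$ in $(2-x)(\sec x+\tan x)+\log(1-\sin x)$.
   Context: A permutation $\sigma$ of $\{1,\dots,n\}$ is alternating if $\sigma_1<\sigma_2>\sigma_3<\sigma_4>\cdots$; $A_n$ is the set of such permutations. -}

module Defs where

open import Data.Nat as ℕ using (ℕ; zero; suc; _<_; _>_; _≤_; _!)
open import Data.Nat.Properties as ℕP using (_<?_; _≤?_)
import Data.Integer as ℤ
open import Data.Rational as ℚ using (ℚ; 0ℚ; 1ℚ; _+_; _*_; -_; _-_)
open import Data.List using (List; []; _∷_; map; concatMap; filter; length; upTo; foldr)
open import Data.List.Relation.Unary.Unique.Propositional using (Unique)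
open import Data.List.Relation.Unary.Unique.DecPropositional ℕ._≟_ using (unique?)
open import Data.Product using (_×_)
open import Data.Unit using (⊤)
open import Data.Bool using (Bool; true; false; if_then_else_)
open import Data.Empty using (⊥)
open import Relation.Nullary using (Dec; yes; no)
open import Relation.Nullary.Decidable using (_×-dec_)

-- Permutations of {1,…,n} are represented as duplicate-free words
-- σ₁σ₂…σₙ of length n with letters in {1,…,n}.

words : ℕ → ℕ → List (List ℕ)
words n zero    = [] ∷ []
words n (suc k) = concatMap (λ w → map (λ a → a ∷ w) (map suc (upTo n))) (words n k)

perms : ℕ → List (List ℕ)
perms n = filter unique? (words n n)

mutual
  AltUp : List ℕ → Set
  AltUp []              = ⊤
  AltUp (a ∷ [])        = ⊤
  AltUp (a ∷ b ∷ r)     = a < b × AltDown (b ∷ r)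

  AltDown : List ℕ → Set
  AltDown []            = ⊤
  AltDown (a ∷ [])      = ⊤
  AltDown (a ∷ b ∷ r)   = a > b × AltUp (b ∷ r)

Alternating : List ℕ → Set
Alternating = AltUp

mutual
  altUp? : (w : List ℕ) → Dec (AltUp w)
  altUp? []          = yes _
  altUp? (a ∷ [])    = yes _
  altUp? (a ∷ b ∷ r) = (a <? b) ×-dec altDown? (b ∷ r)

  altDown? : (w : List ℕ) → Dec (AltDown w)
  altDown? []          = yes _
  altDown? (a ∷ [])    = yes _
  altDown? (a ∷ b ∷ r) = (b <? a) ×-dec altUp? (b ∷ r)

Gap2 : List ℕ → Set
Gap2 (a ∷ b ∷ c ∷ r) = 2 ℕ.+ a ≤ c
Gap2 _               = ⊥

gap2? : (w : List ℕ) → Dec (Gap2 w)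
gap2? (a ∷ b ∷ c ∷ r) = (2 ℕ.+ a) ≤? c
gap2? []              = no (λ ())
gap2? (_ ∷ [])        = no (λ ())
gap2? (_ ∷ _ ∷ [])    = no (λ ())

countAltGap2 : ℕ → ℕ
countAltGap2 n =
  length (filter (λ w → altUp? w ×-dec gap2? w) (perms n))

-- Formal power series over ℚ, represented by coefficient sequences.

PS : Set
PS = ℕ → ℚ

fromℕ : ℕ → ℚ
fromℕ k = ℤ.+ k ℚ./ 1

sumTo : ℕ → (ℕ → ℚ) → ℚ
sumTo n f = foldr _+_ 0ℚ (map f (upTo (suc n)))

_⊕_ : PS → PS → PS
(f ⊕ g) n = f n + g n

_⊛_ : PS → PS → PS
(f ⊛ g) n = sumTo n (λ k → f k * g (n ℕ.∸ k))

constS : ℚ → PS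
constS c zero    = c
constS c (suc _) = 0ℚ

xS : PS
xS 1 = 1ℚ
xS _ = 0ℚ

negS : PS → PS
negS f n = - f n

powS : PS → ℕ → PS
powS f zero    = constS 1ℚ
powS f (suc k) = f ⊛ powS f k

invFact : ℕ → ℚ
invFact k = ℤ.+ 1 ℚ./ (k !) where instance _ = k ℕP.!≢0

isEven : ℕ → Bool
isEven zero          = true
isEven (suc zero)    = false
isEven (suc (suc n)) = isEven n

signPow : ℕ → ℚ
signPow zero    = 1ℚ
signPow (suc m) = - signPow m

-- sin x = Σ_m (-1)^m x^(2m+1)/(2m+1)!,  cos x = Σ_m (-1)^m x^(2m)/(2m)!
sinS : PS
sinS n = if isEven n then 0ℚ else signPow (n ℕ./ 2) * invFact n

cosS : PS
cosS n = if isEven n then signPow (n ℕ./ 2) * invFact n else 0ℚ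

-- For u with zero constant term:
--   1/(1 - u) = Σ_{k≥0} u^k      and   log(1 - u) = - Σ_{k≥1} u^k / k ;
-- the coefficient of x^n only involves k ≤ n.
geomS : PS → PS
geomS u n = sumTo n (λ k → powS u k n)

logOneMinusS : PS → PS
logOneMinusS u n = - sumTo n (λ k → term k)
  where
  term : ℕ → ℚ
  term zero    = 0ℚ
  term (suc j) = powS u (suc j) n * (ℤ.+ 1 ℚ./ suc j)

-- sec x = 1 / cos x = 1 / (1 - (1 - cos x))
secS : PS
secS = geomS (constS 1ℚ ⊕ negS cosS)

tanS : PS
tanS = sinS ⊛ secS

targetS : PS
targetS = ((constS (fromℕ 2) ⊕ negS xS) ⊛ (secS ⊕ tanS)) ⊕ logOneMinusS sinS

{-# OPTIONS --safe #-}
module Submission where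

-- Write n = M + 3 and let E(p, q) be the number of alternating permutations of {1, …, p + q + 1}
-- starting with p + 1 (an Entringer number).  If σ₃ is the (p + 1)-st smallest of σ₃, …, σₙ, then
-- σ₁ + 2 ≤ σ₃ < σ₂ leaves p choices for σ₁ and q + 1 for σ₂, where p + q = M, while σ₃ … σₙ is
-- counted by E(p, q); so the count is Σ_{p+q=M} p (q + 1) E(p, q).  E obeys the boustrophedon rule
-- E(p, q + 1) = E(p + 1, q) + E(q, p), E(p + 1, 0) = 0, and two summations by parts along the
-- antidiagonals turn the weighted sum into 2 E(0, M + 3) − (M + 4) E(0, M + 2).  The coefficients
-- p! q! [xᵖ yᵠ] (cos x + sin y) / cos (x + y) obey the same rule with the same initial value, so
-- E(0, n) = n! [xⁿ] (sec x + tan x).  Finally d/dx log (1 − sin x) = −(sec x + tan x), so n! [xⁿ] of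
-- (2 − x)(sec x + tan x) + log (1 − sin x) is exactly 2 E(0, n) − (n + 1) E(0, n − 1).

open import Data.Nat as ℕ using (ℕ; zero; suc; _<_; _≤_; z≤n; s≤s; _∸_; _!)
import Data.Nat.Properties as ℕP
open import Algebra.Bundles using (CommutativeSemigroup)
open import Algebra.Core using (Op₂)
open import Algebra.Structures using (IsCommutativeSemiring; IsCommutativeRing)
open import Function using (_∘_)
open import Level using (0ℓ)
open import Relation.Binary.PropositionalEquality hiding (J)
open import Defs

module FiniteSums {C : Set} {_+_ _*_ : Op₂ C} {0# 1# : C}
                  (isCommutativeSemiring : IsCommutativeSemiring _≡_ _+_ _*_ 0# 1#) where

  open IsCommutativeSemiring isCommutativeSemiring
    using (+-assoc; +-comm; +-identityˡ; +-identityʳ; *-comm; distribˡ; zeroʳ; +-isCommutativeSemigroup)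

  +-commutativeSemigroup : CommutativeSemigroup 0ℓ 0ℓ
  +-commutativeSemigroup = record { isCommutativeSemigroup = +-isCommutativeSemigroup }

  open import Algebra.Properties.CommutativeSemigroup +-commutativeSemigroup using (interchange)
  open ≡-Reasoning

  Σ< : ℕ → (ℕ → C) → C
  Σ< zero    f = 0#
  Σ< (suc n) f = f 0 + Σ< n (f ∘ suc)

  infix 2 Σ<
  syntax Σ< n (λ i → e) = Σ[ i < n ] e

  Σ-cong-< : ∀ n {f g : ℕ → C} → (∀ i → i < n → f i ≡ g i) → Σ< n f ≡ Σ< n g
  Σ-cong-< zero    eq = refl
  Σ-cong-< (suc n) eq = cong₂ _+_ (eq 0 (s≤s z≤n)) (Σ-cong-< n (λ i i<n → eq (suc i) (s≤s i<n)))

  Σ-cong : ∀ n {f g : ℕ → C} → (∀ i → f i ≡ g i) → Σ< n f ≡ Σ< n g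
  Σ-cong n eq = Σ-cong-< n (λ i _ → eq i)

  Σ-0 : ∀ n {f : ℕ → C} → (∀ i → i < n → f i ≡ 0#) → Σ< n f ≡ 0#
  Σ-0 zero    eq = refl
  Σ-0 (suc n) eq = trans (cong₂ _+_ (eq 0 (s≤s z≤n)) (Σ-0 n (λ i i<n → eq (suc i) (s≤s i<n)))) (+-identityˡ 0#)

  Σ-distrib-+ : ∀ n (f g : ℕ → C) → (Σ[ i < n ] (f i + g i)) ≡ Σ< n f + Σ< n g
  Σ-distrib-+ zero    f g = sym (+-identityˡ 0#)
  Σ-distrib-+ (suc n) f g = trans (cong ((f 0 + g 0) +_) (Σ-distrib-+ n (f ∘ suc) (g ∘ suc))) (interchange _ _ _ _)

  *-distribˡ-Σ : ∀ n c (f : ℕ → C) → c * Σ< n f ≡ (Σ[ i < n ] (c * f i))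
  *-distribˡ-Σ zero    c f = zeroʳ c
  *-distribˡ-Σ (suc n) c f = trans (distribˡ c _ _) (cong ((c * f 0) +_) (*-distribˡ-Σ n c (f ∘ suc)))

  *-distribʳ-Σ : ∀ n c (f : ℕ → C) → Σ< n f * c ≡ (Σ[ i < n ] (f i * c))
  *-distribʳ-Σ n c f = trans (*-comm _ c) (trans (*-distribˡ-Σ n c f) (Σ-cong n (λ i → *-comm c (f i))))

  Σ-split : ∀ m n (f : ℕ → C) → Σ< (m ℕ.+ n) f ≡ Σ< m f + (Σ[ i < n ] f (m ℕ.+ i))
  Σ-split zero    n f = sym (+-identityˡ _)
  Σ-split (suc m) n f = trans (cong (f 0 +_) (Σ-split m n (f ∘ suc))) (sym (+-assoc _ _ _))

  Σ-snoc : ∀ n (f : ℕ → C) → Σ< (suc n) f ≡ Σ< n f + f n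
  Σ-snoc zero    f = trans (+-identityʳ _) (sym (+-identityˡ _))
  Σ-snoc (suc n) f = trans (cong (f 0 +_) (Σ-snoc n (f ∘ suc))) (sym (+-assoc _ _ _))

  Σ-comm : ∀ m n (F : ℕ → ℕ → C) → (Σ[ i < m ] Σ[ j < n ] F i j) ≡ (Σ[ j < n ] Σ[ i < m ] F i j)
  Σ-comm zero    n F = sym (Σ-0 n (λ _ _ → refl))
  Σ-comm (suc m) n F = begin
    Σ< n (F 0) + (Σ[ i < m ] Σ< n (F (suc i)))       ≡⟨ cong (Σ< n (F 0) +_) (Σ-comm m n (F ∘ suc)) ⟩
    Σ< n (F 0) + (Σ[ j < n ] Σ[ i < m ] F (suc i) j) ≡⟨ Σ-distrib-+ n (F 0) _ ⟨
    (Σ[ j < n ] (F 0 j + (Σ[ i < m ] F (suc i) j)))  ∎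

  Σ-reverse : ∀ n (f : ℕ → C) → Σ< (suc n) f ≡ (Σ[ i < suc n ] f (n ∸ i))
  Σ-reverse zero    f = refl
  Σ-reverse (suc n) f = begin
    f 0 + Σ< (suc n) (f ∘ suc)
      ≡⟨ cong (f 0 +_) (Σ-reverse n (f ∘ suc)) ⟩
    f 0 + (Σ[ i < suc n ] f (suc (n ∸ i)))
      ≡⟨ +-comm _ _ ⟩
    (Σ[ i < suc n ] f (suc (n ∸ i))) + f 0
      ≡⟨ cong₂ _+_ (Σ-cong-< (suc n) (λ i i≤n → cong f (sym (ℕP.+-∸-assoc 1 (ℕP.≤-pred i≤n)))))
                   (cong f (sym (ℕP.n∸n≡0 (suc n)))) ⟩
    (Σ[ i < suc n ] f (suc n ∸ i)) + f (suc n ∸ suc n)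
      ≡⟨ Σ-snoc (suc n) (λ i → f (suc n ∸ i)) ⟨
    (Σ[ i < suc (suc n) ] f (suc n ∸ i)) ∎

  Σ₂ : ℕ → (ℕ → ℕ → C) → C
  Σ₂ zero    h = h 0 0
  Σ₂ (suc n) h = h 0 (suc n) + Σ₂ n (λ i j → h (suc i) j)

  infix 2 Σ₂
  syntax Σ₂ n (λ i j → e) = Σ[ i + j ≡ n ] e

  Σ₂-cong-≡ : ∀ n {h h′ : ℕ → ℕ → C} → (∀ i j → i ℕ.+ j ≡ n → h i j ≡ h′ i j) → Σ₂ n h ≡ Σ₂ n h′
  Σ₂-cong-≡ zero    eq = eq 0 0 refl
  Σ₂-cong-≡ (suc n) eq = cong₂ _+_ (eq 0 (suc n) refl) (Σ₂-cong-≡ n (λ i j i+j≡n → eq (suc i) j (cong suc i+j≡n)))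

  Σ₂-cong : ∀ n {h h′ : ℕ → ℕ → C} → (∀ i j → h i j ≡ h′ i j) → Σ₂ n h ≡ Σ₂ n h′
  Σ₂-cong n eq = Σ₂-cong-≡ n (λ i j _ → eq i j)

  Σ₂-0 : ∀ n {h : ℕ → ℕ → C} → (∀ i j → i ℕ.+ j ≡ n → h i j ≡ 0#) → Σ₂ n h ≡ 0#
  Σ₂-0 zero    eq = eq 0 0 refl
  Σ₂-0 (suc n) eq = trans (cong₂ _+_ (eq 0 (suc n) refl) (Σ₂-0 n (λ i j i+j≡n → eq (suc i) j (cong suc i+j≡n))))
                          (+-identityˡ 0#)

  Σ₂-distrib-+ : ∀ n (h g : ℕ → ℕ → C) → (Σ[ i + j ≡ n ] (h i j + g i j)) ≡ Σ₂ n h + Σ₂ n g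
  Σ₂-distrib-+ zero    h g = refl
  Σ₂-distrib-+ (suc n) h g = trans (cong ((h 0 (suc n) + g 0 (suc n)) +_) (Σ₂-distrib-+ n _ _)) (interchange _ _ _ _)

  *-distribˡ-Σ₂ : ∀ n c (h : ℕ → ℕ → C) → c * Σ₂ n h ≡ (Σ[ i + j ≡ n ] (c * h i j))
  *-distribˡ-Σ₂ zero    c h = refl
  *-distribˡ-Σ₂ (suc n) c h = trans (distribˡ c _ _) (cong ((c * h 0 (suc n)) +_) (*-distribˡ-Σ₂ n c _))

  Σ₂-snoc : ∀ n (h : ℕ → ℕ → C) → Σ₂ (suc n) h ≡ (Σ[ i + j ≡ n ] h i (suc j)) + h (suc n) 0
  Σ₂-snoc zero    h = refl
  Σ₂-snoc (suc n) h = trans (cong (h 0 (suc (suc n)) +_) (Σ₂-snoc n (λ i j → h (suc i) j))) (sym (+-assoc _ _ _))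

  Σ₂-swap : ∀ n (h : ℕ → ℕ → C) → Σ₂ n h ≡ (Σ[ i + j ≡ n ] h j i)
  Σ₂-swap zero    h = refl
  Σ₂-swap (suc n) h = begin
    h 0 (suc n) + Σ₂ n (λ i j → h (suc i) j)   ≡⟨ cong (h 0 (suc n) +_) (Σ₂-swap n (λ i j → h (suc i) j)) ⟩
    h 0 (suc n) + (Σ[ i + j ≡ n ] h (suc j) i) ≡⟨ +-comm _ _ ⟩
    (Σ[ i + j ≡ n ] h (suc j) i) + h 0 (suc n) ≡⟨ Σ₂-snoc n (λ i j → h j i) ⟨
    (Σ[ i + j ≡ suc n ] h j i)                  ∎

  Σ₂-Σ-comm : ∀ n m (F : ℕ → ℕ → ℕ → C) → (Σ[ i + j ≡ n ] Σ[ k < m ] F i j k) ≡ (Σ[ k < m ] Σ[ i + j ≡ n ] F i j k)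
  Σ₂-Σ-comm zero    m F = refl
  Σ₂-Σ-comm (suc n) m F = trans (cong (Σ< m (F 0 (suc n)) +_) (Σ₂-Σ-comm n m (λ i j → F (suc i) j)))
                                (sym (Σ-distrib-+ m _ _))

  Σ₂-assoc : ∀ n (F : ℕ → ℕ → ℕ → C) →
             (Σ[ i + j ≡ n ] Σ[ a + b ≡ i ] F a b j) ≡ (Σ[ a + c ≡ n ] Σ[ b + j ≡ c ] F a b j)
  Σ₂-assoc zero    F = refl
  Σ₂-assoc (suc n) F = begin
    F 0 0 (suc n) + (Σ[ i + j ≡ n ] (F 0 (suc i) j + (Σ[ a + b ≡ i ] F (suc a) b j)))
      ≡⟨ cong (F 0 0 (suc n) +_) (Σ₂-distrib-+ n _ _) ⟩
    F 0 0 (suc n) + ((Σ[ i + j ≡ n ] F 0 (suc i) j) + (Σ[ i + j ≡ n ] Σ[ a + b ≡ i ] F (suc a) b j))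
      ≡⟨ cong (λ z → F 0 0 (suc n) + ((Σ[ i + j ≡ n ] F 0 (suc i) j) + z)) (Σ₂-assoc n (F ∘ suc)) ⟩
    F 0 0 (suc n) + ((Σ[ i + j ≡ n ] F 0 (suc i) j) + (Σ[ a + c ≡ n ] Σ[ b + j ≡ c ] F (suc a) b j))
      ≡⟨ +-assoc _ _ _ ⟨
    (Σ[ a + c ≡ suc n ] Σ[ b + j ≡ c ] F a b j) ∎

  Σ-∸≡Σ₂ : ∀ n (h : ℕ → ℕ → C) → (Σ[ k < suc n ] h k (n ∸ k)) ≡ Σ₂ n h
  Σ-∸≡Σ₂ zero    h = +-identityʳ _
  Σ-∸≡Σ₂ (suc n) h = cong (h 0 (suc n) +_) (Σ-∸≡Σ₂ n (λ i j → h (suc i) j))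

module Analytic where

  import Data.Integer as ℤ
  import Data.Integer.Properties as ℤP
  open import Data.Nat.DivMod using (m/n≡1+[m∸n]/n)
  open import Data.Nat.Tactic.RingSolver using (solve-∀)
  open import Data.Rational as ℚ using (ℚ; 0ℚ; 1ℚ; _+_; _*_; -_; _-_; toℚᵘ; fromℚᵘ)
  import Data.Rational.Properties as ℚP
  import Data.Rational.Unnormalised as ℚᵘ
  import Data.Rational.Unnormalised.Properties as ℚᵘP
  open import Data.Rational.Solver using (module +-*-Solver)
  open import Data.Bool using (true; false; not; if_then_else_)
  open import Data.Bool.Properties using (if-float)
  open import Data.List using (map; foldr; applyUpTo)
  open import Data.Empty using (⊥-elim)

  open FiniteSums (IsCommutativeRing.isCommutativeSemiring ℚP.+-*-isCommutativeRing) public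
  open +-*-Solver using (solve; _:+_; _:*_; :-_; _:=_; con)
  open ≡-Reasoning

  fromℚᵘ-homo-+ : ∀ p q → fromℚᵘ (p ℚᵘ.+ q) ≡ fromℚᵘ p + fromℚᵘ q
  fromℚᵘ-homo-+ p q = begin
    fromℚᵘ (p ℚᵘ.+ q)
      ≡⟨ ℚP.fromℚᵘ-cong (ℚᵘP.+-cong (ℚᵘP.≃-sym (ℚP.toℚᵘ-fromℚᵘ p)) (ℚᵘP.≃-sym (ℚP.toℚᵘ-fromℚᵘ q))) ⟩
    fromℚᵘ (toℚᵘ (fromℚᵘ p) ℚᵘ.+ toℚᵘ (fromℚᵘ q))
      ≡⟨ ℚP.fromℚᵘ-cong (ℚᵘP.≃-sym (ℚP.toℚᵘ-homo-+ (fromℚᵘ p) (fromℚᵘ q))) ⟩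
    fromℚᵘ (toℚᵘ (fromℚᵘ p + fromℚᵘ q))
      ≡⟨ ℚP.fromℚᵘ-toℚᵘ _ ⟩
    fromℚᵘ p + fromℚᵘ q ∎

  fromℚᵘ-homo-* : ∀ p q → fromℚᵘ (p ℚᵘ.* q) ≡ fromℚᵘ p * fromℚᵘ q
  fromℚᵘ-homo-* p q = begin
    fromℚᵘ (p ℚᵘ.* q)
      ≡⟨ ℚP.fromℚᵘ-cong (ℚᵘP.*-cong (ℚᵘP.≃-sym (ℚP.toℚᵘ-fromℚᵘ p)) (ℚᵘP.≃-sym (ℚP.toℚᵘ-fromℚᵘ q))) ⟩
    fromℚᵘ (toℚᵘ (fromℚᵘ p) ℚᵘ.* toℚᵘ (fromℚᵘ q))
      ≡⟨ ℚP.fromℚᵘ-cong (ℚᵘP.≃-sym (ℚP.toℚᵘ-homo-* (fromℚᵘ p) (fromℚᵘ q))) ⟩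
    fromℚᵘ (toℚᵘ (fromℚᵘ p * fromℚᵘ q))
      ≡⟨ ℚP.fromℚᵘ-toℚᵘ _ ⟩
    fromℚᵘ p * fromℚᵘ q ∎

  -- fromℕ k is definitionally fromℚᵘ (ℕ→ℚᵘ k), which lets the arithmetic of ℚᵘ do the work.
  ℕ→ℚᵘ : ℕ → ℚᵘ.ℚᵘ
  ℕ→ℚᵘ k = ℚᵘ.mkℚᵘ (ℤ.+ k) 0

  fromℕ-homo-+ : ∀ a b → fromℕ (a ℕ.+ b) ≡ fromℕ a + fromℕ b
  fromℕ-homo-+ a b = begin
    fromℚᵘ (ℕ→ℚᵘ (a ℕ.+ b))     ≡⟨ ℚP.fromℚᵘ-cong {ℕ→ℚᵘ (a ℕ.+ b)} {ℕ→ℚᵘ a ℚᵘ.+ ℕ→ℚᵘ b}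
                                     (ℚᵘ.*≡* (cong (ℤ._* ℤ.+ 1) (sym +-+))) ⟩
    fromℚᵘ (ℕ→ℚᵘ a ℚᵘ.+ ℕ→ℚᵘ b) ≡⟨ fromℚᵘ-homo-+ (ℕ→ℚᵘ a) (ℕ→ℚᵘ b) ⟩
    fromℕ a + fromℕ b            ∎
    where
    +-+ : ℤ.+ a ℤ.* ℤ.+ 1 ℤ.+ ℤ.+ b ℤ.* ℤ.+ 1 ≡ ℤ.+ a ℤ.+ ℤ.+ b
    +-+ = cong₂ ℤ._+_ (ℤP.*-identityʳ (ℤ.+ a)) (ℤP.*-identityʳ (ℤ.+ b))

  fromℕ-homo-* : ∀ a b → fromℕ (a ℕ.* b) ≡ fromℕ a * fromℕ b
  fromℕ-homo-* a b = begin
    fromℚᵘ (ℕ→ℚᵘ (a ℕ.* b))     ≡⟨ ℚP.fromℚᵘ-cong {ℕ→ℚᵘ (a ℕ.* b)} {ℕ→ℚᵘ a ℚᵘ.* ℕ→ℚᵘ b}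
                                     (ℚᵘ.*≡* (cong (ℤ._* ℤ.+ 1) (ℤP.pos-* a b))) ⟩
    fromℚᵘ (ℕ→ℚᵘ a ℚᵘ.* ℕ→ℚᵘ b) ≡⟨ fromℚᵘ-homo-* (ℕ→ℚᵘ a) (ℕ→ℚᵘ b) ⟩
    fromℕ a * fromℕ b            ∎

  fromℕ-suc : ∀ n → fromℕ (suc n) ≡ 1ℚ + fromℕ n
  fromℕ-suc = fromℕ-homo-+ 1

  fromℕ-*-inverse : ∀ d .{{_ : ℕ.NonZero d}} → fromℕ d * (ℤ.+ 1 ℚ./ d) ≡ 1ℚ
  fromℕ-*-inverse (suc d) = begin
    fromℕ (suc d) * (ℤ.+ 1 ℚ./ suc d)          ≡⟨ fromℚᵘ-homo-* (ℕ→ℚᵘ (suc d)) d⁻¹ ⟨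
    fromℚᵘ (ℕ→ℚᵘ (suc d) ℚᵘ.* d⁻¹)             ≡⟨ ℚP.fromℚᵘ-cong {ℕ→ℚᵘ (suc d) ℚᵘ.* d⁻¹} {ℚᵘ.1ℚᵘ} (ℚᵘ.*≡* eq) ⟩
    1ℚ                                         ∎
    where
    d⁻¹ : ℚᵘ.ℚᵘ
    d⁻¹ = ℚᵘ.mkℚᵘ (ℤ.+ 1) d
    eq : (ℤ.+ suc d ℤ.* ℤ.+ 1) ℤ.* ℤ.+ 1 ≡ ℤ.+ 1 ℤ.* ℤ.+ (1 ℕ.* suc d)
    eq = trans (ℤP.*-identityʳ _)
        (trans (ℤP.*-identityʳ _) (sym (trans (ℤP.*-identityˡ _) (cong ℤ.+_ (ℕP.*-identityˡ (suc d))))))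

  fromℕ-cancelˡ : ∀ k {x y} → fromℕ (suc k) * x ≡ fromℕ (suc k) * y → x ≡ y
  fromℕ-cancelˡ k {x} {y} eq = begin
    x                       ≡⟨ solve 1 (λ x → x := con 1ℚ :* x) refl x ⟩
    1ℚ * x                  ≡⟨ cong (_* x) (fromℕ-*-inverse (suc k)) ⟨
    (fromℕ (suc k) * k⁻¹) * x ≡⟨ solve 3 (λ a b x → (a :* b) :* x := b :* (a :* x)) refl (fromℕ (suc k)) k⁻¹ x ⟩
    k⁻¹ * (fromℕ (suc k) * x) ≡⟨ cong (k⁻¹ *_) eq ⟩
    k⁻¹ * (fromℕ (suc k) * y) ≡⟨ solve 3 (λ a b y → b :* (a :* y) := (a :* b) :* y) refl (fromℕ (suc k)) k⁻¹ y ⟩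
    (fromℕ (suc k) * k⁻¹) * y ≡⟨ cong (_* y) (fromℕ-*-inverse (suc k)) ⟩
    1ℚ * y                  ≡⟨ ℚP.*-identityˡ y ⟩
    y                       ∎
    where
    k⁻¹ : ℚ
    k⁻¹ = ℤ.+ 1 ℚ./ suc k

  -- Formal power series

  Σ-foldr-applyUpTo : ∀ (f : ℕ → ℚ) (g : ℕ → ℕ) m → foldr _+_ 0ℚ (map f (applyUpTo g m)) ≡ Σ< m (f ∘ g)
  Σ-foldr-applyUpTo f g zero    = refl
  Σ-foldr-applyUpTo f g (suc m) = cong (f (g 0) +_) (Σ-foldr-applyUpTo f (g ∘ suc) m)

  sumTo≡Σ : ∀ n f → sumTo n f ≡ Σ< (suc n) f
  sumTo≡Σ n f = Σ-foldr-applyUpTo f (λ i → i) (suc n)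

  ⊛-coeff : ∀ f g n → (f ⊛ g) n ≡ (Σ[ i + j ≡ n ] f i * g j)
  ⊛-coeff f g n = trans (sumTo≡Σ n (λ k → f k * g (n ℕ.∸ k))) (Σ-∸≡Σ₂ n (λ i j → f i * g j))

  ⊛-cong : ∀ {f f′ g g′} → f ≗ f′ → g ≗ g′ → f ⊛ g ≗ f′ ⊛ g′
  ⊛-cong {f} {f′} {g} {g′} f≗f′ g≗g′ n = begin
    (f ⊛ g) n                    ≡⟨ ⊛-coeff f g n ⟩
    (Σ[ i + j ≡ n ] f i * g j)   ≡⟨ Σ₂-cong n (λ i j → cong₂ _*_ (f≗f′ i) (g≗g′ j)) ⟩
    (Σ[ i + j ≡ n ] f′ i * g′ j) ≡⟨ ⊛-coeff f′ g′ n ⟨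
    (f′ ⊛ g′) n                  ∎

  ⊛-congˡ : ∀ {f f′} g → f ≗ f′ → f ⊛ g ≗ f′ ⊛ g
  ⊛-congˡ {f} {f′} g f≗f′ = ⊛-cong {f} {f′} {g} {g} f≗f′ (λ _ → refl)

  ⊛-congʳ : ∀ f {g g′} → g ≗ g′ → f ⊛ g ≗ f ⊛ g′
  ⊛-congʳ f {g} {g′} g≗g′ = ⊛-cong {f} {f} {g} {g′} (λ _ → refl) g≗g′

  ⊛-comm : ∀ f g → f ⊛ g ≗ g ⊛ f
  ⊛-comm f g n = begin
    (f ⊛ g) n                  ≡⟨ ⊛-coeff f g n ⟩
    (Σ[ i + j ≡ n ] f i * g j) ≡⟨ Σ₂-swap n _ ⟩
    (Σ[ i + j ≡ n ] f j * g i) ≡⟨ Σ₂-cong n (λ i j → ℚP.*-comm (f j) (g i)) ⟩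
    (Σ[ i + j ≡ n ] g i * f j) ≡⟨ ⊛-coeff g f n ⟨
    (g ⊛ f) n                  ∎

  ⊛-assoc : ∀ f g h → (f ⊛ g) ⊛ h ≗ f ⊛ (g ⊛ h)
  ⊛-assoc f g h n = begin
    ((f ⊛ g) ⊛ h) n
      ≡⟨ ⊛-coeff (f ⊛ g) h n ⟩
    (Σ[ i + j ≡ n ] (f ⊛ g) i * h j)
      ≡⟨ Σ₂-cong n (λ i j → cong (_* h j) (⊛-coeff f g i)) ⟩
    (Σ[ i + j ≡ n ] (Σ[ a + b ≡ i ] f a * g b) * h j)
      ≡⟨ Σ₂-cong n (λ i j → trans (ℚP.*-comm _ (h j)) (*-distribˡ-Σ₂ i (h j) _)) ⟩
    (Σ[ i + j ≡ n ] Σ[ a + b ≡ i ] h j * (f a * g b))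
      ≡⟨ Σ₂-cong n (λ i j → Σ₂-cong i (λ a b →
           solve 3 (λ x y z → z :* (x :* y) := x :* (y :* z)) refl (f a) (g b) (h j))) ⟩
    (Σ[ i + j ≡ n ] Σ[ a + b ≡ i ] f a * (g b * h j))
      ≡⟨ Σ₂-assoc n (λ a b j → f a * (g b * h j)) ⟩
    (Σ[ a + c ≡ n ] Σ[ b + j ≡ c ] f a * (g b * h j))
      ≡⟨ Σ₂-cong n (λ a c → *-distribˡ-Σ₂ c (f a) _) ⟨
    (Σ[ a + c ≡ n ] f a * (Σ[ b + j ≡ c ] g b * h j))
      ≡⟨ Σ₂-cong n (λ a c → cong (f a *_) (⊛-coeff g h c)) ⟨
    (Σ[ a + c ≡ n ] f a * (g ⊛ h) c)
      ≡⟨ ⊛-coeff f (g ⊛ h) n ⟨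
    (f ⊛ (g ⊛ h)) n ∎

  ⊛-distribˡ-⊕ : ∀ f g h → f ⊛ (g ⊕ h) ≗ (f ⊛ g) ⊕ (f ⊛ h)
  ⊛-distribˡ-⊕ f g h n = begin
    (f ⊛ (g ⊕ h)) n                                        ≡⟨ ⊛-coeff f (g ⊕ h) n ⟩
    (Σ[ i + j ≡ n ] f i * (g j + h j))                      ≡⟨ Σ₂-cong n (λ i j → ℚP.*-distribˡ-+ (f i) (g j) (h j)) ⟩
    (Σ[ i + j ≡ n ] (f i * g j + f i * h j))                ≡⟨ Σ₂-distrib-+ n _ _ ⟩
    (Σ[ i + j ≡ n ] f i * g j) + (Σ[ i + j ≡ n ] f i * h j) ≡⟨ cong₂ _+_ (⊛-coeff f g n) (⊛-coeff f h n) ⟨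
    (f ⊛ g) n + (f ⊛ h) n                                   ∎

  ⊛-distribʳ-⊕ : ∀ f g h → (g ⊕ h) ⊛ f ≗ (g ⊛ f) ⊕ (h ⊛ f)
  ⊛-distribʳ-⊕ f g h n = begin
    ((g ⊕ h) ⊛ f) n       ≡⟨ ⊛-comm (g ⊕ h) f n ⟩
    (f ⊛ (g ⊕ h)) n       ≡⟨ ⊛-distribˡ-⊕ f g h n ⟩
    (f ⊛ g) n + (f ⊛ h) n ≡⟨ cong₂ _+_ (⊛-comm f g n) (⊛-comm f h n) ⟩
    (g ⊛ f) n + (h ⊛ f) n ∎

  infixl 7 _·_
  _·_ : ℚ → PS → PS
  (c · f) n = c * f n

  ⊛-·ʳ : ∀ c f g → f ⊛ (c · g) ≗ c · (f ⊛ g)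
  ⊛-·ʳ c f g n = begin
    (f ⊛ (c · g)) n                  ≡⟨ ⊛-coeff f (c · g) n ⟩
    (Σ[ i + j ≡ n ] f i * (c * g j)) ≡⟨ Σ₂-cong n (λ i j → solve 3 (λ x y z → x :* (y :* z) := y :* (x :* z))
                                                                  refl (f i) c (g j)) ⟩
    (Σ[ i + j ≡ n ] c * (f i * g j)) ≡⟨ *-distribˡ-Σ₂ n c _ ⟨
    c * (Σ[ i + j ≡ n ] f i * g j)   ≡⟨ cong (c *_) (⊛-coeff f g n) ⟨
    c * (f ⊛ g) n                    ∎

  ·-⊛ : ∀ c f g → (c · f) ⊛ g ≗ c · (f ⊛ g)
  ·-⊛ c f g n = trans (⊛-comm (c · f) g n) (trans (⊛-·ʳ c g f n) (cong (c *_) (⊛-comm g f n)))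

  constS-⊛ : ∀ c f → constS c ⊛ f ≗ c · f
  constS-⊛ c f zero    = ⊛-coeff (constS c) f 0
  constS-⊛ c f (suc n) = begin
    (constS c ⊛ f) (suc n)                                   ≡⟨ ⊛-coeff (constS c) f (suc n) ⟩
    c * f (suc n) + (Σ[ i + j ≡ n ] constS c (suc i) * f j)  ≡⟨ cong (c * f (suc n) +_)
                                                                  (Σ₂-0 n (λ i j _ → ℚP.*-zeroˡ (f j))) ⟩
    c * f (suc n) + 0ℚ                                        ≡⟨ ℚP.+-identityʳ _ ⟩
    c * f (suc n)                                             ∎

  ⊛-identityˡ : ∀ f → constS 1ℚ ⊛ f ≗ f
  ⊛-identityˡ f n = trans (constS-⊛ 1ℚ f n) (ℚP.*-identityˡ (f n))

  ⊛-identityʳ : ∀ f → f ⊛ constS 1ℚ ≗ f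
  ⊛-identityʳ f n = trans (⊛-comm f (constS 1ℚ) n) (⊛-identityˡ f n)

  negS≗-1· : ∀ f → negS f ≗ (- 1ℚ) · f
  negS≗-1· f n = solve 1 (λ x → :- x := con (- 1ℚ) :* x) refl (f n)

  negS-⊛ : ∀ f g → negS f ⊛ g ≗ negS (f ⊛ g)
  negS-⊛ f g n = begin
    (negS f ⊛ g) n       ≡⟨ ⊛-congˡ g (negS≗-1· f) n ⟩
    ((- 1ℚ · f) ⊛ g) n   ≡⟨ ·-⊛ (- 1ℚ) f g n ⟩
    - 1ℚ * (f ⊛ g) n     ≡⟨ negS≗-1· (f ⊛ g) n ⟨
    - (f ⊛ g) n          ∎

  ⊛-negS : ∀ f g → f ⊛ negS g ≗ negS (f ⊛ g)
  ⊛-negS f g n = trans (⊛-comm f (negS g) n) (trans (negS-⊛ g f n) (cong -_ (⊛-comm g f n)))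

  xS-⊛ : ∀ f n → (xS ⊛ f) (suc n) ≡ f n
  xS-⊛ f zero    = trans (⊛-coeff xS f 1) (solve 2 (λ a b → con 0ℚ :* a :+ con 1ℚ :* b := b) refl (f 1) (f 0))
  xS-⊛ f (suc n) = begin
    (xS ⊛ f) (suc (suc n))
      ≡⟨ ⊛-coeff xS f (suc (suc n)) ⟩
    0ℚ * f (suc (suc n)) + (1ℚ * f (suc n) + (Σ[ i + j ≡ n ] 0ℚ * f j))
      ≡⟨ cong (λ z → 0ℚ * f (suc (suc n)) + (1ℚ * f (suc n) + z))
            (Σ₂-0 n (λ i j _ → ℚP.*-zeroˡ (f j))) ⟩
    0ℚ * f (suc (suc n)) + (1ℚ * f (suc n) + 0ℚ)
      ≡⟨ solve 2 (λ a b → con 0ℚ :* a :+ (con 1ℚ :* b :+ con 0ℚ) := b)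
            refl (f (suc (suc n))) (f (suc n)) ⟩
    f (suc n) ∎

  D : PS → PS
  D f n = fromℕ (suc n) * f (suc n)

  D-cong : ∀ {f g} → f ≗ g → D f ≗ D g
  D-cong f≗g n = cong (fromℕ (suc n) *_) (f≗g (suc n))

  D-⊕ : ∀ f g → D (f ⊕ g) ≗ D f ⊕ D g
  D-⊕ f g n = ℚP.*-distribˡ-+ (fromℕ (suc n)) (f (suc n)) (g (suc n))

  D-⊛ : ∀ f g → D (f ⊛ g) ≗ (D f ⊛ g) ⊕ (f ⊛ D g)
  D-⊛ f g n = begin
    fromℕ (suc n) * (f ⊛ g) (suc n)
      ≡⟨ cong (fromℕ (suc n) *_) (⊛-coeff f g (suc n)) ⟩
    fromℕ (suc n) * (Σ[ i + j ≡ suc n ] f i * g j)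
      ≡⟨ *-distribˡ-Σ₂ (suc n) (fromℕ (suc n)) (λ i j → f i * g j) ⟩
    (Σ[ i + j ≡ suc n ] fromℕ (suc n) * (f i * g j))
      ≡⟨ Σ₂-cong-≡ (suc n) (λ i j i+j≡1+n →
           trans (cong (λ k → fromℕ k * (f i * g j)) (sym i+j≡1+n))
                 (trans (cong (_* (f i * g j)) (fromℕ-homo-+ i j))
                        (ℚP.*-distribʳ-+ (f i * g j) (fromℕ i) (fromℕ j)))) ⟩
    (Σ[ i + j ≡ suc n ] (fromℕ i * (f i * g j) + fromℕ j * (f i * g j)))
      ≡⟨ Σ₂-distrib-+ (suc n) (λ i j → fromℕ i * (f i * g j)) (λ i j → fromℕ j * (f i * g j)) ⟩
    (Σ[ i + j ≡ suc n ] fromℕ i * (f i * g j)) + (Σ[ i + j ≡ suc n ] fromℕ j * (f i * g j))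
      ≡⟨ cong₂ _+_ left right ⟩
    (D f ⊛ g) n + (f ⊛ D g) n ∎
    where
    left : (Σ[ i + j ≡ suc n ] fromℕ i * (f i * g j)) ≡ (D f ⊛ g) n
    left = begin
      0ℚ * (f 0 * g (suc n)) + (Σ[ i + j ≡ n ] fromℕ (suc i) * (f (suc i) * g j))
        ≡⟨ cong (_+ (Σ[ i + j ≡ n ] fromℕ (suc i) * (f (suc i) * g j))) (ℚP.*-zeroˡ (f 0 * g (suc n))) ⟩
      0ℚ + (Σ[ i + j ≡ n ] fromℕ (suc i) * (f (suc i) * g j))
        ≡⟨ ℚP.+-identityˡ _ ⟩
      (Σ[ i + j ≡ n ] fromℕ (suc i) * (f (suc i) * g j))
        ≡⟨ Σ₂-cong n (λ i j → ℚP.*-assoc (fromℕ (suc i)) (f (suc i)) (g j)) ⟨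
      (Σ[ i + j ≡ n ] D f i * g j)
        ≡⟨ ⊛-coeff (D f) g n ⟨
      (D f ⊛ g) n ∎
    right : (Σ[ i + j ≡ suc n ] fromℕ j * (f i * g j)) ≡ (f ⊛ D g) n
    right = begin
      (Σ[ i + j ≡ suc n ] fromℕ j * (f i * g j))
        ≡⟨ Σ₂-snoc n (λ i j → fromℕ j * (f i * g j)) ⟩
      (Σ[ i + j ≡ n ] fromℕ (suc j) * (f i * g (suc j))) + 0ℚ * (f (suc n) * g 0)
        ≡⟨ cong ((Σ[ i + j ≡ n ] fromℕ (suc j) * (f i * g (suc j))) +_) (ℚP.*-zeroˡ (f (suc n) * g 0)) ⟩
      (Σ[ i + j ≡ n ] fromℕ (suc j) * (f i * g (suc j))) + 0ℚ
        ≡⟨ ℚP.+-identityʳ _ ⟩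
      (Σ[ i + j ≡ n ] fromℕ (suc j) * (f i * g (suc j)))
        ≡⟨ Σ₂-cong n (λ i j → solve 3 (λ x y z → x :* (y :* z) := y :* (x :* z))
                                      refl (fromℕ (suc j)) (f i) (g (suc j))) ⟩
      (Σ[ i + j ≡ n ] f i * D g j)
        ≡⟨ ⊛-coeff f (D g) n ⟨
      (f ⊛ D g) n ∎

  D-injective : ∀ {f g} → D f ≗ D g → f 0 ≡ g 0 → f ≗ g
  D-injective Df≗Dg f₀≡g₀ zero    = f₀≡g₀
  D-injective Df≗Dg f₀≡g₀ (suc n) = fromℕ-cancelˡ n (Df≗Dg n)

  powS-vanish : ∀ u → u 0 ≡ 0ℚ → ∀ k n → n < k → powS u k n ≡ 0ℚ
  powS-vanish u u₀≡0 (suc k) n n<1+k = trans (⊛-coeff u (powS u k) n) (Σ₂-0 n vanish)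
    where
    vanish : ∀ i j → i ℕ.+ j ≡ n → u i * powS u k j ≡ 0ℚ
    vanish zero    j _       = trans (cong (_* powS u k j) u₀≡0) (ℚP.*-zeroˡ (powS u k j))
    vanish (suc i) j 1+i+j≡n = trans (cong (u (suc i) *_) (powS-vanish u u₀≡0 k j j<k)) (ℚP.*-zeroʳ (u (suc i)))
      where
      j<k : j < k
      j<k = ℕP.<-≤-trans (subst (j <_) 1+i+j≡n (ℕP.m<n+m j (s≤s z≤n))) (ℕP.≤-pred n<1+k)

  geomS-extend : ∀ u → u 0 ≡ 0ℚ → ∀ n d → geomS u n ≡ (Σ[ k < suc (n ℕ.+ d) ] powS u k n)
  geomS-extend u u₀≡0 n d = begin
    geomS u n
      ≡⟨ sumTo≡Σ n (λ k → powS u k n) ⟩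
    (Σ[ k < suc n ] powS u k n)
      ≡⟨ ℚP.+-identityʳ _ ⟨
    (Σ[ k < suc n ] powS u k n) + 0ℚ
      ≡⟨ cong (Σ< (suc n) (λ k → powS u k n) +_) (Σ-0 d (λ i _ →
           powS-vanish u u₀≡0 _ n (s≤s (ℕP.m≤m+n n i)))) ⟨
    (Σ[ k < suc n ] powS u k n) + (Σ[ i < d ] powS u (suc n ℕ.+ i) n)
      ≡⟨ Σ-split (suc n) d (λ k → powS u k n) ⟨
    (Σ[ k < suc (n ℕ.+ d) ] powS u k n) ∎

  ⊛-geomS : ∀ f u → u 0 ≡ 0ℚ → ∀ n → (f ⊛ geomS u) n ≡ (Σ[ k < suc n ] (f ⊛ powS u k) n)
  ⊛-geomS f u u₀≡0 n = begin
    (f ⊛ geomS u) n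
      ≡⟨ ⊛-coeff f (geomS u) n ⟩
    (Σ[ i + j ≡ n ] f i * geomS u j)
      ≡⟨ Σ₂-cong-≡ n (λ i j i+j≡n → cong (f i *_)
          (trans (geomS-extend u u₀≡0 j i)
                 (cong (λ m → Σ< (suc m) (λ k → powS u k j))
                       (trans (ℕP.+-comm j i) i+j≡n)))) ⟩
    (Σ[ i + j ≡ n ] f i * (Σ[ k < suc n ] powS u k j))
      ≡⟨ Σ₂-cong n (λ i j → *-distribˡ-Σ (suc n) (f i) (λ k → powS u k j)) ⟩
    (Σ[ i + j ≡ n ] Σ[ k < suc n ] f i * powS u k j)
      ≡⟨ Σ₂-Σ-comm n (suc n) (λ i j k → f i * powS u k j) ⟩
    (Σ[ k < suc n ] Σ[ i + j ≡ n ] f i * powS u k j)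
      ≡⟨ Σ-cong (suc n) (λ k → ⊛-coeff f (powS u k) n) ⟨
    (Σ[ k < suc n ] (f ⊛ powS u k) n) ∎

  geomS-unfold : ∀ u → u 0 ≡ 0ℚ → geomS u ≗ constS 1ℚ ⊕ (u ⊛ geomS u)
  geomS-unfold u u₀≡0 n = begin
    geomS u n                                        ≡⟨ geomS-extend u u₀≡0 n 1 ⟩
    (Σ[ k < suc (n ℕ.+ 1) ] powS u k n)              ≡⟨ cong (λ m → Σ< (suc m) (λ k → powS u k n)) (ℕP.+-comm n 1) ⟩
    constS 1ℚ n + (Σ[ k < suc n ] powS u (suc k) n)  ≡⟨ cong (constS 1ℚ n +_) (⊛-geomS u u u₀≡0 n) ⟨
    constS 1ℚ n + (u ⊛ geomS u) n                    ∎

  geomS-inverse : ∀ u → u 0 ≡ 0ℚ → (constS 1ℚ ⊕ negS u) ⊛ geomS u ≗ constS 1ℚ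
  geomS-inverse u u₀≡0 n = begin
    ((constS 1ℚ ⊕ negS u) ⊛ G) n              ≡⟨ ⊛-distribʳ-⊕ G (constS 1ℚ) (negS u) n ⟩
    (constS 1ℚ ⊛ G) n + (negS u ⊛ G) n        ≡⟨ cong₂ _+_ (⊛-identityˡ G n) (negS-⊛ u G n) ⟩
    G n - (u ⊛ G) n                           ≡⟨ cong (_- (u ⊛ G) n) (geomS-unfold u u₀≡0 n) ⟩
    (constS 1ℚ n + (u ⊛ G) n) - (u ⊛ G) n     ≡⟨ solve 2 (λ a b → (a :+ b) :+ (:- b) := a) refl (constS 1ℚ n) _ ⟩
    constS 1ℚ n                               ∎
    where
    G : PS
    G = geomS u

  -- Sine, cosine, secant and tangent

  fromℕ-!-*-invFact : ∀ n → fromℕ (n !) * invFact n ≡ 1ℚ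
  fromℕ-!-*-invFact n = fromℕ-*-inverse (n !) {{n ℕP.!≢0}}

  fromℕ-*-invFact-suc : ∀ n → fromℕ (suc n) * invFact (suc n) ≡ invFact n
  fromℕ-*-invFact-suc n = begin
    a * x                     ≡⟨ ℚP.*-identityʳ (a * x) ⟨
    (a * x) * 1ℚ              ≡⟨ cong ((a * x) *_) (fromℕ-!-*-invFact n) ⟨
    (a * x) * (b * y)         ≡⟨ solve 4 (λ a x b y → (a :* x) :* (b :* y) := ((a :* b) :* x) :* y) refl a x b y ⟩
    ((a * b) * x) * y         ≡⟨ cong (λ z → (z * x) * y) (fromℕ-homo-* (suc n) (n !)) ⟨
    (fromℕ (suc n !) * x) * y ≡⟨ cong (_* y) (fromℕ-!-*-invFact (suc n)) ⟩
    1ℚ * y                    ≡⟨ ℚP.*-identityˡ y ⟩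
    y                         ∎
    where
    a b x y : ℚ
    a = fromℕ (suc n)
    b = fromℕ (n !)
    x = invFact (suc n)
    y = invFact n

  isEven-suc : ∀ n → isEven (suc n) ≡ not (isEven n)
  isEven-suc zero          = refl
  isEven-suc (suc zero)    = refl
  isEven-suc (suc (suc n)) = isEven-suc n

  half-suc : ∀ n → suc n ℕ./ 2 ≡ (if isEven n then n ℕ./ 2 else suc (n ℕ./ 2))
  half-suc zero          = refl
  half-suc (suc zero)    = refl
  half-suc (suc (suc n)) = begin
    suc (suc (suc n)) ℕ./ 2
      ≡⟨ m/n≡1+[m∸n]/n {suc (suc (suc n))} {2} (s≤s (s≤s z≤n)) ⟩
    suc (suc n ℕ./ 2)
      ≡⟨ cong suc (half-suc n) ⟩
    suc (if isEven n then n ℕ./ 2 else suc (n ℕ./ 2))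
      ≡⟨ if-float suc (isEven n) ⟩
    (if isEven n then suc (n ℕ./ 2) else suc (suc (n ℕ./ 2)))
      ≡⟨ cong (λ h → if isEven n then h else suc h)
            (m/n≡1+[m∸n]/n {suc (suc n)} {2} (s≤s (s≤s z≤n))) ⟨
    (if isEven n then suc (suc n) ℕ./ 2 else suc (suc (suc n) ℕ./ 2)) ∎

  sinS-suc : ∀ n → sinS (suc n) ≡ (if isEven n then signPow (n ℕ./ 2) * invFact (suc n) else 0ℚ)
  sinS-suc n = trans (cong₂ (λ b h → if b then 0ℚ else signPow h * invFact (suc n)) (isEven-suc n) (half-suc n))
                     (by-parity (isEven n))
    where
    by-parity : ∀ b → (if not b then 0ℚ else signPow (if b then n ℕ./ 2 else suc (n ℕ./ 2)) * invFact (suc n))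
                    ≡ (if b then signPow (n ℕ./ 2) * invFact (suc n) else 0ℚ)
    by-parity true  = refl
    by-parity false = refl

  cosS-suc : ∀ n → cosS (suc n) ≡ (if isEven n then 0ℚ else - signPow (n ℕ./ 2) * invFact (suc n))
  cosS-suc n = trans (cong₂ (λ b h → if b then signPow h * invFact (suc n) else 0ℚ) (isEven-suc n) (half-suc n))
                     (by-parity (isEven n))
    where
    by-parity : ∀ b → (if not b then signPow (if b then n ℕ./ 2 else suc (n ℕ./ 2)) * invFact (suc n) else 0ℚ)
                    ≡ (if b then 0ℚ else - signPow (n ℕ./ 2) * invFact (suc n))
    by-parity true  = refl
    by-parity false = refl

  D-sinS : D sinS ≗ cosS
  D-sinS n = begin
    fromℕ (suc n) * sinS (suc n)
      ≡⟨ cong (fromℕ (suc n) *_) (sinS-suc n) ⟩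
    fromℕ (suc n) * (if isEven n then s * invFact (suc n) else 0ℚ)
      ≡⟨ if-float (fromℕ (suc n) *_) (isEven n) ⟩
    (if isEven n then fromℕ (suc n) * (s * invFact (suc n)) else fromℕ (suc n) * 0ℚ)
      ≡⟨ cong₂ (λ x y → if isEven n then x else y)
           (trans (solve 3 (λ a s x → a :* (s :* x) := s :* (a :* x))
                         refl (fromℕ (suc n)) s (invFact (suc n)))
                  (cong (s *_) (fromℕ-*-invFact-suc n)))
           (ℚP.*-zeroʳ (fromℕ (suc n))) ⟩
    (if isEven n then s * invFact n else 0ℚ) ∎
    where
    s : ℚ
    s = signPow (n ℕ./ 2)

  D-cosS : D cosS ≗ negS sinS
  D-cosS n = begin
    fromℕ (suc n) * cosS (suc n)
      ≡⟨ cong (fromℕ (suc n) *_) (cosS-suc n) ⟩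
    fromℕ (suc n) * (if isEven n then 0ℚ else - s * invFact (suc n))
      ≡⟨ if-float (fromℕ (suc n) *_) (isEven n) ⟩
    (if isEven n then fromℕ (suc n) * 0ℚ else fromℕ (suc n) * (- s * invFact (suc n)))
      ≡⟨ cong₂ (λ x y → if isEven n then x else y)
           (ℚP.*-zeroʳ (fromℕ (suc n)))
           (trans (solve 3 (λ a s x → a :* ((:- s) :* x) := :- (s :* (a :* x)))
                         refl (fromℕ (suc n)) s (invFact (suc n)))
                  (cong (λ z → - (s * z)) (fromℕ-*-invFact-suc n))) ⟩
    (if isEven n then 0ℚ else - (s * invFact n))
      ≡⟨ if-float -_ (isEven n) ⟨
    - (if isEven n then 0ℚ else s * invFact n) ∎
    where
    s : ℚ
    s = signPow (n ℕ./ 2)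

  sin²+cos²≗1 : (sinS ⊛ sinS) ⊕ (cosS ⊛ cosS) ≗ constS 1ℚ
  sin²+cos²≗1 = D-injective derivative-vanishes refl
    where
    s c : PS
    s = sinS
    c = cosS
    derivative-vanishes : D ((s ⊛ s) ⊕ (c ⊛ c)) ≗ D (constS 1ℚ)
    derivative-vanishes n = begin
      D ((s ⊛ s) ⊕ (c ⊛ c)) n
        ≡⟨ D-⊕ (s ⊛ s) (c ⊛ c) n ⟩
      D (s ⊛ s) n + D (c ⊛ c) n
        ≡⟨ cong₂ _+_ (D-⊛ s s n) (D-⊛ c c n) ⟩
      ((D s ⊛ s) n + (s ⊛ D s) n) + ((D c ⊛ c) n + (c ⊛ D c) n)
        ≡⟨ cong₂ (λ x y → (x + y) + ((D c ⊛ c) n + (c ⊛ D c) n))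
              (⊛-congˡ s D-sinS n) (⊛-congʳ s D-sinS n) ⟩
      ((c ⊛ s) n + (s ⊛ c) n) + ((D c ⊛ c) n + (c ⊛ D c) n)
        ≡⟨ cong₂ (λ x y → ((c ⊛ s) n + (s ⊛ c) n) + (x + y))
              (trans (⊛-congˡ c D-cosS n) (negS-⊛ s c n))
              (trans (⊛-congʳ c D-cosS n) (⊛-negS c s n)) ⟩
      ((c ⊛ s) n + (s ⊛ c) n) + (- (s ⊛ c) n + - (c ⊛ s) n)
        ≡⟨ solve 2 (λ p q → (p :+ q) :+ ((:- q) :+ (:- p)) := con 0ℚ)
                  refl ((c ⊛ s) n) ((s ⊛ c) n) ⟩
      0ℚ
        ≡⟨ ℚP.*-zeroʳ (fromℕ (suc n)) ⟨
      D (constS 1ℚ) n ∎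

  cosS-⊛-secS : cosS ⊛ secS ≗ constS 1ℚ
  cosS-⊛-secS n = trans (⊛-congˡ secS cos≗1-[1-cos] n) (geomS-inverse (constS 1ℚ ⊕ negS cosS) refl n)
    where
    cos≗1-[1-cos] : cosS ≗ constS 1ℚ ⊕ negS (constS 1ℚ ⊕ negS cosS)
    cos≗1-[1-cos] m = solve 2 (λ a b → b := a :+ (:- (a :+ (:- b)))) refl (constS 1ℚ m) (cosS m)

  cosS-cancelˡ : ∀ f g → cosS ⊛ f ≗ cosS ⊛ g → f ≗ g
  cosS-cancelˡ f g cos·f≗cos·g n = begin
    f n                       ≡⟨ ⊛-identityˡ f n ⟨
    (constS 1ℚ ⊛ f) n         ≡⟨ ⊛-congˡ f sec·cos≗1 n ⟨
    ((secS ⊛ cosS) ⊛ f) n     ≡⟨ ⊛-assoc secS cosS f n ⟩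
    (secS ⊛ (cosS ⊛ f)) n     ≡⟨ ⊛-congʳ secS cos·f≗cos·g n ⟩
    (secS ⊛ (cosS ⊛ g)) n     ≡⟨ ⊛-assoc secS cosS g n ⟨
    ((secS ⊛ cosS) ⊛ g) n     ≡⟨ ⊛-congˡ g sec·cos≗1 n ⟩
    (constS 1ℚ ⊛ g) n         ≡⟨ ⊛-identityˡ g n ⟩
    g n                       ∎
    where
    sec·cos≗1 : secS ⊛ cosS ≗ constS 1ℚ
    sec·cos≗1 m = trans (⊛-comm secS cosS m) (cosS-⊛-secS m)

  cosS-⊛-[secS+tanS] : cosS ⊛ (secS ⊕ tanS) ≗ constS 1ℚ ⊕ sinS
  cosS-⊛-[secS+tanS] n = begin
    (cosS ⊛ (secS ⊕ tanS)) n                         ≡⟨ ⊛-distribˡ-⊕ cosS secS tanS n ⟩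
    (cosS ⊛ secS) n + (cosS ⊛ (sinS ⊛ secS)) n       ≡⟨ cong₂ _+_ (cosS-⊛-secS n) cos·tan≗sin ⟩
    constS 1ℚ n + sinS n                             ∎
    where
    cos·tan≗sin : (cosS ⊛ (sinS ⊛ secS)) n ≡ sinS n
    cos·tan≗sin = begin
      (cosS ⊛ (sinS ⊛ secS)) n   ≡⟨ ⊛-assoc cosS sinS secS n ⟨
      ((cosS ⊛ sinS) ⊛ secS) n   ≡⟨ ⊛-congˡ secS (⊛-comm cosS sinS) n ⟩
      ((sinS ⊛ cosS) ⊛ secS) n   ≡⟨ ⊛-assoc sinS cosS secS n ⟩
      (sinS ⊛ (cosS ⊛ secS)) n   ≡⟨ ⊛-congʳ sinS cosS-⊛-secS n ⟩
      (sinS ⊛ constS 1ℚ) n       ≡⟨ ⊛-identityʳ sinS n ⟩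
      sinS n                     ∎

  -- After multiplying by cos x both sides become 1 + sin x, since cos² x = (1 − sin x)(1 + sin x).
  cosS-⊛-geomS-sinS : cosS ⊛ geomS sinS ≗ secS ⊕ tanS
  cosS-⊛-geomS-sinS =
    cosS-cancelˡ (cosS ⊛ G) (secS ⊕ tanS) (λ n → trans (cos²·G n) (sym (cosS-⊛-[secS+tanS] n)))
    where
    s c G : PS
    s = sinS
    c = cosS
    G = geomS sinS
    s·G : (s ⊛ G) ≗ G ⊕ negS (constS 1ℚ)
    s·G n = begin
      (s ⊛ G) n
        ≡⟨ solve 2 (λ a b → b := (a :+ b) :+ (:- a)) refl (constS 1ℚ n) ((s ⊛ G) n) ⟩
      (constS 1ℚ n + (s ⊛ G) n) - constS 1ℚ n
        ≡⟨ cong (_- constS 1ℚ n) (geomS-unfold s refl n) ⟨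
      G n - constS 1ℚ n ∎
    cos² : (c ⊛ c) ≗ constS 1ℚ ⊕ negS (s ⊛ s)
    cos² n = begin
      (c ⊛ c) n                          ≡⟨ solve 2 (λ a b → b := (a :+ b) :+ (:- a)) refl ((s ⊛ s) n) ((c ⊛ c) n) ⟩
      ((s ⊛ s) n + (c ⊛ c) n) - (s ⊛ s) n ≡⟨ cong (_- (s ⊛ s) n) (sin²+cos²≗1 n) ⟩
      constS 1ℚ n - (s ⊛ s) n            ∎
    cos²·G : (c ⊛ (c ⊛ G)) ≗ constS 1ℚ ⊕ s
    cos²·G n = begin
      (c ⊛ (c ⊛ G)) n
        ≡⟨ ⊛-assoc c c G n ⟨
      ((c ⊛ c) ⊛ G) n
        ≡⟨ ⊛-congˡ G cos² n ⟩
      ((constS 1ℚ ⊕ negS (s ⊛ s)) ⊛ G) n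
        ≡⟨ ⊛-distribʳ-⊕ G (constS 1ℚ) (negS (s ⊛ s)) n ⟩
      (constS 1ℚ ⊛ G) n + (negS (s ⊛ s) ⊛ G) n
        ≡⟨ cong₂ _+_ (⊛-identityˡ G n) (negS-⊛ (s ⊛ s) G n) ⟩
      G n - ((s ⊛ s) ⊛ G) n
        ≡⟨ cong (λ z → G n - z) (trans (⊛-assoc s s G n) (⊛-congʳ s s·G n)) ⟩
      G n - (s ⊛ (G ⊕ negS (constS 1ℚ))) n
        ≡⟨ cong (λ z → G n - z) (⊛-distribˡ-⊕ s G (negS (constS 1ℚ)) n) ⟩
      G n - ((s ⊛ G) n + (s ⊛ negS (constS 1ℚ)) n)
        ≡⟨ cong₂ (λ z w → G n - (z + w)) (s·G n)
              (trans (⊛-negS s (constS 1ℚ) n) (cong -_ (⊛-identityʳ s n))) ⟩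
      G n - ((G n - constS 1ℚ n) - s n)
        ≡⟨ solve 3 (λ g o x → g :+ (:- ((g :+ (:- o)) :+ (:- x))) := o :+ x)
                  refl (G n) (constS 1ℚ n) (s n) ⟩
      constS 1ℚ n + s n ∎

  D-powS-sinS : ∀ k → D (powS sinS (suc k)) ≗ fromℕ (suc k) · (cosS ⊛ powS sinS k)
  D-powS-sinS zero n = begin
    D (sinS ⊛ constS 1ℚ) n ≡⟨ D-cong (⊛-identityʳ sinS) n ⟩
    D sinS n               ≡⟨ D-sinS n ⟩
    cosS n                 ≡⟨ ⊛-identityʳ cosS n ⟨
    (cosS ⊛ constS 1ℚ) n   ≡⟨ ℚP.*-identityˡ _ ⟨
    1ℚ * (cosS ⊛ constS 1ℚ) n ∎
  D-powS-sinS (suc k) n = begin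
    D (s ⊛ P) n
      ≡⟨ D-⊛ s P n ⟩
    (D s ⊛ P) n + (s ⊛ D P) n
      ≡⟨ cong₂ _+_ (⊛-congˡ P D-sinS n) (⊛-congʳ s (D-powS-sinS k) n) ⟩
    (c ⊛ P) n + (s ⊛ (fromℕ (suc k) · (c ⊛ Q))) n
      ≡⟨ cong ((c ⊛ P) n +_) (⊛-·ʳ (fromℕ (suc k)) s (c ⊛ Q) n) ⟩
    (c ⊛ P) n + fromℕ (suc k) * (s ⊛ (c ⊛ Q)) n
      ≡⟨ cong (λ z → (c ⊛ P) n + fromℕ (suc k) * z) s·c·Q≗c·P ⟩
    (c ⊛ P) n + fromℕ (suc k) * (c ⊛ P) n
      ≡⟨ solve 2 (λ a x → a :+ x :* a := (con 1ℚ :+ x) :* a) refl ((c ⊛ P) n) (fromℕ (suc k)) ⟩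
    (1ℚ + fromℕ (suc k)) * (c ⊛ P) n
      ≡⟨ cong (_* (c ⊛ P) n) (fromℕ-suc (suc k)) ⟨
    fromℕ (suc (suc k)) * (c ⊛ P) n ∎
    where
    s c Q P : PS
    s = sinS
    c = cosS
    Q = powS sinS k
    P = powS sinS (suc k)
    s·c·Q≗c·P : (s ⊛ (c ⊛ Q)) n ≡ (c ⊛ P) n
    s·c·Q≗c·P = begin
      (s ⊛ (c ⊛ Q)) n ≡⟨ ⊛-assoc s c Q n ⟨
      ((s ⊛ c) ⊛ Q) n ≡⟨ ⊛-congˡ Q (⊛-comm s c) n ⟩
      ((c ⊛ s) ⊛ Q) n ≡⟨ ⊛-assoc c s Q n ⟩
      (c ⊛ P) n       ∎

  logOneMinusS-coeff : ∀ u n → logOneMinusS u n ≡ - (Σ[ j < n ] powS u (suc j) n * (ℤ.+ 1 ℚ./ suc j))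
  logOneMinusS-coeff u n = drop-zeroth-term (λ _ → refl)
    where
    -- t is the summand local to the definition of logOneMinusS; its value at 0 is 0ℚ.
    drop-zeroth-term : ∀ {t} → (∀ j → t (suc j) ≡ powS u (suc j) n * (ℤ.+ 1 ℚ./ suc j)) →
                       - (0ℚ + foldr _+_ 0ℚ (map t (applyUpTo suc n)))
                       ≡ - (Σ[ j < n ] powS u (suc j) n * (ℤ.+ 1 ℚ./ suc j))
    drop-zeroth-term {t} t-suc =
      cong -_ (trans (ℚP.+-identityˡ _) (trans (Σ-foldr-applyUpTo t suc n) (Σ-cong n t-suc)))

  D-logOneMinusS-sinS : D (logOneMinusS sinS) ≗ negS (secS ⊕ tanS)
  D-logOneMinusS-sinS m = begin
    fromℕ (suc m) * logOneMinusS sinS (suc m)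
      ≡⟨ cong (fromℕ (suc m) *_) (logOneMinusS-coeff sinS (suc m)) ⟩
    fromℕ (suc m) * - (Σ[ j < suc m ] powS sinS (suc j) (suc m) * (ℤ.+ 1 ℚ./ suc j))
      ≡⟨ ℚP.neg-distribʳ-* (fromℕ (suc m)) _ ⟨
    - (fromℕ (suc m) * (Σ[ j < suc m ] powS sinS (suc j) (suc m) * (ℤ.+ 1 ℚ./ suc j)))
      ≡⟨ cong -_ (*-distribˡ-Σ (suc m) (fromℕ (suc m)) (λ j → powS sinS (suc j) (suc m) * (ℤ.+ 1 ℚ./ suc j))) ⟩
    - (Σ[ j < suc m ] fromℕ (suc m) * (powS sinS (suc j) (suc m) * (ℤ.+ 1 ℚ./ suc j)))
      ≡⟨ cong -_ (Σ-cong (suc m) term≡) ⟩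
    - (Σ[ j < suc m ] (cosS ⊛ powS sinS j) m)
      ≡⟨ cong -_ (⊛-geomS cosS sinS refl m) ⟨
    - (cosS ⊛ geomS sinS) m
      ≡⟨ cong -_ (cosS-⊛-geomS-sinS m) ⟩
    - (secS ⊕ tanS) m ∎
    where
    term≡ : ∀ j → fromℕ (suc m) * (powS sinS (suc j) (suc m) * (ℤ.+ 1 ℚ./ suc j)) ≡ (cosS ⊛ powS sinS j) m
    term≡ j = begin
      fromℕ (suc m) * (powS sinS (suc j) (suc m) * j⁻¹)
        ≡⟨ ℚP.*-assoc (fromℕ (suc m)) _ j⁻¹ ⟨
      D (powS sinS (suc j)) m * j⁻¹
        ≡⟨ cong (_* j⁻¹) (D-powS-sinS j m) ⟩
      (fromℕ (suc j) * x) * j⁻¹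
        ≡⟨ solve 3 (λ a x i → (a :* x) :* i := x :* (a :* i)) refl (fromℕ (suc j)) x j⁻¹ ⟩
      x * (fromℕ (suc j) * j⁻¹)
        ≡⟨ cong (x *_) (fromℕ-*-inverse (suc j)) ⟩
      x * 1ℚ
        ≡⟨ ℚP.*-identityʳ x ⟩
      x ∎
      where
      j⁻¹ x : ℚ
      j⁻¹ = ℤ.+ 1 ℚ./ suc j
      x = (cosS ⊛ powS sinS j) m

  [2-x]-⊛-suc : ∀ f m → ((constS (fromℕ 2) ⊕ negS xS) ⊛ f) (suc m) ≡ fromℕ 2 * f (suc m) - f m
  [2-x]-⊛-suc f m = begin
    ((constS (fromℕ 2) ⊕ negS xS) ⊛ f) (suc m)
      ≡⟨ ⊛-distribʳ-⊕ f (constS (fromℕ 2)) (negS xS) (suc m) ⟩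
    (constS (fromℕ 2) ⊛ f) (suc m) + (negS xS ⊛ f) (suc m)
      ≡⟨ cong₂ _+_ (constS-⊛ (fromℕ 2) f (suc m)) (negS-⊛ xS f (suc m)) ⟩
    fromℕ 2 * f (suc m) - (xS ⊛ f) (suc m)
      ≡⟨ cong (λ z → fromℕ 2 * f (suc m) - z) (xS-⊛ f m) ⟩
    fromℕ 2 * f (suc m) - f m ∎

  targetS-coeff : ∀ m → fromℕ (suc m !) * targetS (suc m)
                      ≡ fromℕ 2 * (fromℕ (suc m !) * (secS ⊕ tanS) (suc m))
                        - fromℕ (suc (suc m)) * (fromℕ (m !) * (secS ⊕ tanS) m)
  targetS-coeff m = begin
    fromℕ (suc m !) * (((constS (fromℕ 2) ⊕ negS xS) ⊛ y) (suc m) + L)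
      ≡⟨ cong₂ (λ z w → z * (w + L)) (fromℕ-homo-* (suc m) (m !)) ([2-x]-⊛-suc y m) ⟩
    (a * b) * ((fromℕ 2 * y₁ - y₀) + L)
      ≡⟨ solve 6 (λ a b t y₁ y₀ L → (a :* b) :* ((t :* y₁ :+ (:- y₀)) :+ L)
                                    := t :* ((a :* b) :* y₁) :+ (:- (a :* (b :* y₀))) :+ b :* (a :* L))
                 refl a b (fromℕ 2) y₁ y₀ L ⟩
    fromℕ 2 * ((a * b) * y₁) - a * (b * y₀) + b * (a * L)
      ≡⟨ cong₂ (λ z w → fromℕ 2 * (z * y₁) - a * (b * y₀) + b * w)
               (sym (fromℕ-homo-* (suc m) (m !))) (D-logOneMinusS-sinS m) ⟩
    fromℕ 2 * (fromℕ (suc m !) * y₁) - a * (b * y₀) + b * - y₀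
      ≡⟨ solve 4 (λ X a b y₀ → X :+ (:- (a :* (b :* y₀))) :+ b :* (:- y₀) := X :+ (:- ((con 1ℚ :+ a) :* (b :* y₀))))
                 refl (fromℕ 2 * (fromℕ (suc m !) * y₁)) a b y₀ ⟩
    fromℕ 2 * (fromℕ (suc m !) * y₁) - (1ℚ + a) * (b * y₀)
      ≡⟨ cong (λ z → fromℕ 2 * (fromℕ (suc m !) * y₁) - z * (b * y₀)) (fromℕ-suc (suc m)) ⟨
    fromℕ 2 * (fromℕ (suc m !) * y₁) - fromℕ (suc (suc m)) * (b * y₀) ∎
    where
    y : PS
    y = secS ⊕ tanS
    a b y₁ y₀ L : ℚ
    a = fromℕ (suc m)
    b = fromℕ (m !)
    y₁ = y (suc m)
    y₀ = y m
    L = logOneMinusS sinS (suc m)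

  -- Boustrophedon arrays

  -- The recurrence of the Entringer numbers E(p + q, p), indexed so that each antidiagonal p + q = n
  -- is one row of the Seidel–Entringer (boustrophedon) triangle.
  record IsBoustrophedon (X : ℕ → ℕ → ℚ) : Set where
    field
      step : ∀ p q → X p (suc q) ≡ X (suc p) q + X q p
      edge : ∀ p → X (suc p) 0 ≡ 0ℚ

  boustrophedon-unique : ∀ {X Y} → IsBoustrophedon X → IsBoustrophedon Y → X 0 0 ≡ Y 0 0 → ∀ p q → X p q ≡ Y p q
  boustrophedon-unique {X} {Y} isX isY X₀₀≡Y₀₀ p q = on-antidiagonal (p ℕ.+ q) q p refl
    where
    module X = IsBoustrophedon isX
    module Y = IsBoustrophedon isY
    on-antidiagonal : ∀ m q p → p ℕ.+ q ≡ m → X p q ≡ Y p q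
    on-antidiagonal m       zero    zero    _ = X₀₀≡Y₀₀
    on-antidiagonal m       zero    (suc p) _ = trans (X.edge p) (sym (Y.edge p))
    on-antidiagonal zero    (suc q) p       p+q≡0 = ⊥-elim (ℕP.0≢1+n (trans (sym p+q≡0) (ℕP.+-suc p q)))
    on-antidiagonal (suc m) (suc q) p       p+q≡m = begin
      X p (suc q)           ≡⟨ X.step p q ⟩
      X (suc p) q + X q p   ≡⟨ cong₂ _+_ (on-antidiagonal (suc m) q (suc p) 1+p+q≡1+m) (on-antidiagonal m p q q+p≡m) ⟩
      Y (suc p) q + Y q p   ≡⟨ Y.step p q ⟨
      Y p (suc q)           ∎
      where
      1+p+q≡1+m : suc p ℕ.+ q ≡ suc m
      1+p+q≡1+m = trans (sym (ℕP.+-suc p q)) p+q≡m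
      q+p≡m : q ℕ.+ p ≡ m
      q+p≡m = trans (ℕP.+-comm q p) (ℕP.suc-injective 1+p+q≡1+m)

  ∇ : (ℕ → ℚ) → ℕ → ℚ
  ∇ w zero    = w 0
  ∇ w (suc p) = w (suc p) - w p

  -- On the antidiagonal p + q = M the weight p (q + 1) depends on q alone, as a quadratic;
  -- its backward difference on the next antidiagonal is linear, and the difference of that is 2.
  quadraticWeight linearWeight : ℕ → ℕ → ℚ
  quadraticWeight M q = (fromℕ M - fromℕ q) * (fromℕ q + 1ℚ)
  linearWeight    M q = fromℕ 2 * fromℕ q - (fromℕ M + fromℕ 2)

  fromℕ-*-≡-quadraticWeight : ∀ M p q → p ℕ.+ q ≡ M → fromℕ (p ℕ.* suc q) ≡ quadraticWeight M q
  fromℕ-*-≡-quadraticWeight M p q p+q≡M = begin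
    fromℕ (p ℕ.* suc q)
      ≡⟨ trans (fromℕ-homo-* p (suc q)) (cong (fromℕ p *_) (fromℕ-suc q)) ⟩
    fromℕ p * (1ℚ + fromℕ q)
      ≡⟨ solve 2 (λ a b → a :* (con 1ℚ :+ b) := ((a :+ b) :+ (:- b)) :* (b :+ con 1ℚ)) refl (fromℕ p) (fromℕ q) ⟩
    ((fromℕ p + fromℕ q) - fromℕ q) * (fromℕ q + 1ℚ)
      ≡⟨ cong (λ z → (z - fromℕ q) * (fromℕ q + 1ℚ)) (trans (sym (fromℕ-homo-+ p q)) (cong fromℕ p+q≡M)) ⟩
    quadraticWeight M q ∎

  ∇-quadraticWeight : ∀ M p q → p ℕ.+ q ≡ suc M → ∇ (quadraticWeight M) p ≡ linearWeight M q
  ∇-quadraticWeight M zero    q q≡1+M = begin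
    (m - 0ℚ) * (0ℚ + 1ℚ)
      ≡⟨ solve 1 (λ m → (m :+ (:- con 0ℚ)) :* (con 0ℚ :+ con 1ℚ)
                        := con (fromℕ 2) :* (con 1ℚ :+ m) :+ (:- (m :+ con (fromℕ 2)))) refl m ⟩
    fromℕ 2 * (1ℚ + m) - (m + fromℕ 2)
      ≡⟨ cong (λ z → fromℕ 2 * z - (m + fromℕ 2)) (trans (sym (fromℕ-suc M)) (cong fromℕ (sym q≡1+M))) ⟩
    linearWeight M q ∎
    where
    m : ℚ
    m = fromℕ M
  ∇-quadraticWeight M (suc p) q 1+p+q≡1+M = begin
    (fromℕ M - fromℕ (suc p)) * (fromℕ (suc p) + 1ℚ) - (fromℕ M - P) * (P + 1ℚ)
      ≡⟨ cong₂ (λ x y → (x - y) * (y + 1ℚ) - (x - P) * (P + 1ℚ)) M≡P+Q (fromℕ-suc p) ⟩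
    ((P + Q) - (1ℚ + P)) * ((1ℚ + P) + 1ℚ) - ((P + Q) - P) * (P + 1ℚ)
      ≡⟨ solve 2 (λ P Q → ((P :+ Q) :+ (:- (con 1ℚ :+ P))) :* ((con 1ℚ :+ P) :+ con 1ℚ)
                          :+ (:- (((P :+ Q) :+ (:- P)) :* (P :+ con 1ℚ)))
                          := con (fromℕ 2) :* Q :+ (:- ((P :+ Q) :+ con (fromℕ 2)))) refl P Q ⟩
    fromℕ 2 * Q - ((P + Q) + fromℕ 2)
      ≡⟨ cong (λ x → fromℕ 2 * Q - (x + fromℕ 2)) M≡P+Q ⟨
    linearWeight M q ∎
    where
    P Q : ℚ
    P = fromℕ p
    Q = fromℕ q
    M≡P+Q : fromℕ M ≡ P + Q
    M≡P+Q = trans (cong fromℕ (sym (ℕP.suc-injective 1+p+q≡1+M))) (fromℕ-homo-+ p q)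

  ∇-linearWeight-suc : ∀ M p → ∇ (linearWeight M) (suc p) ≡ fromℕ 2
  ∇-linearWeight-suc M p = begin
    fromℕ 2 * fromℕ (suc p) - (m + fromℕ 2) - (fromℕ 2 * fromℕ p - (m + fromℕ 2))
      ≡⟨ cong (λ z → fromℕ 2 * z - (m + fromℕ 2) - (fromℕ 2 * fromℕ p - (m + fromℕ 2))) (fromℕ-suc p) ⟩
    fromℕ 2 * (1ℚ + fromℕ p) - (m + fromℕ 2) - (fromℕ 2 * fromℕ p - (m + fromℕ 2))
      ≡⟨ solve 2 (λ x m → (con (fromℕ 2) :* (con 1ℚ :+ x) :+ (:- (m :+ con (fromℕ 2))))
                          :+ (:- (con (fromℕ 2) :* x :+ (:- (m :+ con (fromℕ 2))))) := con (fromℕ 2))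
                 refl (fromℕ p) m ⟩
    fromℕ 2 ∎
    where
    m : ℚ
    m = fromℕ M

  module _ {X : ℕ → ℕ → ℚ} (isBoustrophedon : IsBoustrophedon X) where

    open IsBoustrophedon isBoustrophedon

    Σ₂-step : ∀ m (w : ℕ → ℚ) → (Σ[ p + q ≡ suc m ] w p * X p q)
                                ≡ (Σ[ p + q ≡ m ] w p * X (suc p) q) + (Σ[ p + q ≡ m ] w q * X p q)
    Σ₂-step m w = begin
      (Σ[ p + q ≡ suc m ] w p * X p q)
        ≡⟨ Σ₂-snoc m (λ p q → w p * X p q) ⟩
      (Σ[ p + q ≡ m ] w p * X p (suc q)) + w (suc m) * X (suc m) 0
        ≡⟨ cong₂ _+_ (Σ₂-cong m (λ p q → trans (cong (w p *_) (step p q)) (ℚP.*-distribˡ-+ (w p) _ _)))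
                     (trans (cong (w (suc m) *_) (edge m)) (ℚP.*-zeroʳ (w (suc m)))) ⟩
      (Σ[ p + q ≡ m ] (w p * X (suc p) q + w p * X q p)) + 0ℚ
        ≡⟨ ℚP.+-identityʳ _ ⟩
      (Σ[ p + q ≡ m ] (w p * X (suc p) q + w p * X q p))
        ≡⟨ Σ₂-distrib-+ m (λ p q → w p * X (suc p) q) (λ p q → w p * X q p) ⟩
      (Σ[ p + q ≡ m ] w p * X (suc p) q) + (Σ[ p + q ≡ m ] w p * X q p)
        ≡⟨ cong ((Σ[ p + q ≡ m ] w p * X (suc p) q) +_) (Σ₂-swap m (λ p q → w p * X q p)) ⟩
      (Σ[ p + q ≡ m ] w p * X (suc p) q) + (Σ[ p + q ≡ m ] w q * X p q) ∎

    summation-by-parts : ∀ m (w : ℕ → ℚ) → (Σ[ p + q ≡ suc m ] ∇ w p * X p q) ≡ (Σ[ p + q ≡ m ] w q * X p q)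
    summation-by-parts m w = begin
      w 0 * X 0 (suc m) + (Σ[ p + q ≡ m ] (w (suc p) - w p) * X (suc p) q)
        ≡⟨ cong (w 0 * X 0 (suc m) +_) (Σ₂-cong m (λ p q →
             solve 3 (λ a b x → (a :+ (:- b)) :* x := a :* x :+ con (- 1ℚ) :* (b :* x))
                     refl (w (suc p)) (w p) (X (suc p) q))) ⟩
      w 0 * X 0 (suc m) + (Σ[ p + q ≡ m ] (w (suc p) * X (suc p) q + - 1ℚ * (w p * X (suc p) q)))
        ≡⟨ cong (w 0 * X 0 (suc m) +_) (trans (Σ₂-distrib-+ m _ _) (cong (A +_) (sym (*-distribˡ-Σ₂ m (- 1ℚ) _)))) ⟩
      w 0 * X 0 (suc m) + (A + - 1ℚ * B)
        ≡⟨ solve 3 (λ a b c → a :+ (b :+ con (- 1ℚ) :* c) := (a :+ b) :+ (:- c)) refl (w 0 * X 0 (suc m)) A B ⟩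
      (Σ[ p + q ≡ suc m ] w p * X p q) - B
        ≡⟨ cong (_- B) (Σ₂-step m w) ⟩
      (B + (Σ[ p + q ≡ m ] w q * X p q)) - B
        ≡⟨ solve 2 (λ b c → (b :+ c) :+ (:- b) := c) refl B _ ⟩
      (Σ[ p + q ≡ m ] w q * X p q) ∎
      where
      A B : ℚ
      A = Σ[ p + q ≡ m ] w (suc p) * X (suc p) q
      B = Σ[ p + q ≡ m ] w p * X (suc p) q

    antidiagonal-sum : ∀ m → X 0 (suc m) ≡ Σ₂ m X
    antidiagonal-sum m = begin
      X 0 (suc m)                                  ≡⟨ solve 1 (λ x → x := con 1ℚ :* x :+ con 0ℚ) refl (X 0 (suc m)) ⟩
      1ℚ * X 0 (suc m) + 0ℚ                        ≡⟨ cong (1ℚ * X 0 (suc m) +_)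
                                                         (Σ₂-0 m (λ p q _ → ℚP.*-zeroˡ (X (suc p) q))) ⟨
      (Σ[ p + q ≡ suc m ] ∇ (λ _ → 1ℚ) p * X p q)  ≡⟨ summation-by-parts m (λ _ → 1ℚ) ⟩
      (Σ[ p + q ≡ m ] 1ℚ * X p q)                  ≡⟨ Σ₂-cong m (λ p q → ℚP.*-identityˡ (X p q)) ⟩
      Σ₂ m X                                       ∎

    Σ₂-∇-linearWeight : ∀ M → (Σ[ p + q ≡ 2 ℕ.+ M ] ∇ (linearWeight M) p * X p q)
                              ≡ fromℕ 2 * X 0 (3 ℕ.+ M) - fromℕ (4 ℕ.+ M) * X 0 (2 ℕ.+ M)
    Σ₂-∇-linearWeight M = begin
      linearWeight M 0 * a + (Σ[ p + q ≡ suc M ] ∇ (linearWeight M) (suc p) * X (suc p) q)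
        ≡⟨ cong (linearWeight M 0 * a +_) (Σ₂-cong (suc M) (λ p q → cong (_* X (suc p) q) (∇-linearWeight-suc M p))) ⟩
      linearWeight M 0 * a + (Σ[ p + q ≡ suc M ] fromℕ 2 * X (suc p) q)
        ≡⟨ cong (linearWeight M 0 * a +_) (*-distribˡ-Σ₂ (suc M) (fromℕ 2) (λ p q → X (suc p) q)) ⟨
      linearWeight M 0 * a + fromℕ 2 * (Σ[ p + q ≡ suc M ] X (suc p) q)
        ≡⟨ cong (λ z → linearWeight M 0 * a + fromℕ 2 * z) tail≡b-a ⟩
      linearWeight M 0 * a + fromℕ 2 * (b - a)
        ≡⟨ solve 3 (λ m a b → (con (fromℕ 2) :* con 0ℚ :+ (:- (m :+ con (fromℕ 2)))) :* a
                              :+ con (fromℕ 2) :* (b :+ (:- a))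
                              := con (fromℕ 2) :* b :+ (:- ((con (fromℕ 4) :+ m) :* a)))
                   refl (fromℕ M) a b ⟩
      fromℕ 2 * b - (fromℕ 4 + fromℕ M) * a
        ≡⟨ cong (λ z → fromℕ 2 * b - z * a) (fromℕ-homo-+ 4 M) ⟨
      fromℕ 2 * b - fromℕ (4 ℕ.+ M) * a ∎
      where
      a b : ℚ
      a = X 0 (2 ℕ.+ M)
      b = X 0 (3 ℕ.+ M)
      tail≡b-a : (Σ[ p + q ≡ suc M ] X (suc p) q) ≡ b - a
      tail≡b-a = begin
        (Σ[ p + q ≡ suc M ] X (suc p) q)           ≡⟨ solve 2 (λ r a → r := (a :+ r) :+ (:- a)) refl _ a ⟩
        (a + (Σ[ p + q ≡ suc M ] X (suc p) q)) - a ≡⟨ cong (_- a) (antidiagonal-sum (2 ℕ.+ M)) ⟨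
        b - a                                      ∎

    weighted-antidiagonal-sum : ∀ M → (Σ[ p + q ≡ M ] fromℕ (p ℕ.* suc q) * X p q)
                                      ≡ fromℕ 2 * X 0 (3 ℕ.+ M) - fromℕ (4 ℕ.+ M) * X 0 (2 ℕ.+ M)
    weighted-antidiagonal-sum M = begin
      (Σ[ p + q ≡ M ] fromℕ (p ℕ.* suc q) * X p q)
        ≡⟨ Σ₂-cong-≡ M (λ p q p+q≡M → cong (_* X p q) (fromℕ-*-≡-quadraticWeight M p q p+q≡M)) ⟩
      (Σ[ p + q ≡ M ] quadraticWeight M q * X p q)
        ≡⟨ summation-by-parts M (quadraticWeight M) ⟨
      (Σ[ p + q ≡ suc M ] ∇ (quadraticWeight M) p * X p q)
        ≡⟨ Σ₂-cong-≡ (suc M) (λ p q p+q≡1+M → cong (_* X p q) (∇-quadraticWeight M p q p+q≡1+M)) ⟩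
      (Σ[ p + q ≡ suc M ] linearWeight M q * X p q)
        ≡⟨ summation-by-parts (suc M) (linearWeight M) ⟨
      (Σ[ p + q ≡ 2 ℕ.+ M ] ∇ (linearWeight M) p * X p q)
        ≡⟨ Σ₂-∇-linearWeight M ⟩
      fromℕ 2 * X 0 (3 ℕ.+ M) - fromℕ (4 ℕ.+ M) * X 0 (2 ℕ.+ M) ∎

  -- The Entringer array of (cos x + sin y) / cos (x + y)

  -- binomial i j is the binomial coefficient (i + j choose i).
  binomial : ℕ → ℕ → ℕ
  binomial zero    j       = 1
  binomial (suc i) zero    = 1
  binomial (suc i) (suc j) = binomial i (suc j) ℕ.+ binomial (suc i) j

  binomial-*-! : ∀ i j → binomial i j ℕ.* (i ! ℕ.* j !) ≡ (i ℕ.+ j) !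
  binomial-*-! zero    j       = trans (ℕP.*-identityˡ (1 ℕ.* j !)) (ℕP.*-identityˡ (j !))
  binomial-*-! (suc i) zero    =
    trans (ℕP.*-identityˡ _) (trans (ℕP.*-identityʳ _) (cong _! (sym (ℕP.+-identityʳ (suc i)))))
  binomial-*-! (suc i) (suc j) = begin
    (A ℕ.+ B) ℕ.* ((suc i ℕ.* a) ℕ.* (suc j ℕ.* b))
      ≡⟨ regroup A B a b (suc i) (suc j) ⟩
    suc i ℕ.* (A ℕ.* (a ℕ.* (suc j ℕ.* b))) ℕ.+ suc j ℕ.* (B ℕ.* ((suc i ℕ.* a) ℕ.* b))
      ≡⟨ cong₂ (λ x y → suc i ℕ.* x ℕ.+ suc j ℕ.* y) (binomial-*-! i (suc j))
                                                   (trans (binomial-*-! (suc i) j) (cong _! (sym (ℕP.+-suc i j)))) ⟩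
    suc i ℕ.* (i ℕ.+ suc j) ! ℕ.+ suc j ℕ.* (i ℕ.+ suc j) !
      ≡⟨ ℕP.*-distribʳ-+ ((i ℕ.+ suc j) !) (suc i) (suc j) ⟨
    (suc i ℕ.+ suc j) ℕ.* (i ℕ.+ suc j) ! ∎
    where
    regroup : ∀ A B a b m n → (A ℕ.+ B) ℕ.* ((m ℕ.* a) ℕ.* (n ℕ.* b))
                              ≡ m ℕ.* (A ℕ.* (a ℕ.* (n ℕ.* b))) ℕ.+ n ℕ.* (B ℕ.* ((m ℕ.* a) ℕ.* b))
    regroup = solve-∀
    A B a b : ℕ
    A = binomial i (suc j)
    B = binomial (suc i) j
    a = i !
    b = j !

  egfCoeff : PS → ℕ → ℚ
  egfCoeff f i = fromℕ (i !) * f i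

  !-*-⊛ : ∀ f g n → fromℕ (n !) * (f ⊛ g) n ≡ (Σ[ i + j ≡ n ] fromℕ (binomial i j) * (egfCoeff f i * egfCoeff g j))
  !-*-⊛ f g n = begin
    fromℕ (n !) * (f ⊛ g) n                       ≡⟨ cong (fromℕ (n !) *_) (⊛-coeff f g n) ⟩
    fromℕ (n !) * (Σ[ i + j ≡ n ] f i * g j)      ≡⟨ *-distribˡ-Σ₂ n (fromℕ (n !)) (λ i j → f i * g j) ⟩
    (Σ[ i + j ≡ n ] fromℕ (n !) * (f i * g j))    ≡⟨ Σ₂-cong-≡ n term≡ ⟩
    (Σ[ i + j ≡ n ] fromℕ (binomial i j) * (egfCoeff f i * egfCoeff g j)) ∎
    where
    term≡ : ∀ i j → i ℕ.+ j ≡ n → fromℕ (n !) * (f i * g j) ≡ fromℕ (binomial i j) * (egfCoeff f i * egfCoeff g j)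
    term≡ i j i+j≡n = begin
      fromℕ (n !) * (f i * g j)
        ≡⟨ cong (λ k → fromℕ k * (f i * g j)) (trans (cong _! (sym i+j≡n)) (sym (binomial-*-! i j))) ⟩
      fromℕ (binomial i j ℕ.* (i ! ℕ.* j !)) * (f i * g j)
        ≡⟨ cong (_* (f i * g j)) (trans (fromℕ-homo-* (binomial i j) _)
                                        (cong (fromℕ (binomial i j) *_) (fromℕ-homo-* (i !) (j !)))) ⟩
      (fromℕ (binomial i j) * (fromℕ (i !) * fromℕ (j !))) * (f i * g j)
        ≡⟨ solve 5 (λ c a b x y → (c :* (a :* b)) :* (x :* y) := c :* ((a :* x) :* (b :* y)))
                   refl (fromℕ (binomial i j)) (fromℕ (i !)) (fromℕ (j !)) (f i) (g j) ⟩
      fromℕ (binomial i j) * (egfCoeff f i * egfCoeff g j) ∎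

  egfCoeff-suc : ∀ f i → egfCoeff f (suc i) ≡ egfCoeff (D f) i
  egfCoeff-suc f i = begin
    fromℕ (suc i ℕ.* i !) * f (suc i)           ≡⟨ cong (_* f (suc i)) (fromℕ-homo-* (suc i) (i !)) ⟩
    (fromℕ (suc i) * fromℕ (i !)) * f (suc i)   ≡⟨ solve 3 (λ a b x → (a :* b) :* x := b :* (a :* x))
                                                          refl (fromℕ (suc i)) (fromℕ (i !)) (f (suc i)) ⟩
    fromℕ (i !) * (fromℕ (suc i) * f (suc i))   ∎

  egfCoeff-sinS-suc : ∀ i → egfCoeff sinS (suc i) ≡ egfCoeff cosS i
  egfCoeff-sinS-suc i = trans (egfCoeff-suc sinS i) (cong (fromℕ (i !) *_) (D-sinS i))

  egfCoeff-cosS-suc : ∀ i → egfCoeff cosS (suc i) ≡ - egfCoeff sinS i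
  egfCoeff-cosS-suc i = trans (egfCoeff-suc cosS i)
    (trans (cong (fromℕ (i !) *_) (D-cosS i)) (sym (ℚP.neg-distribʳ-* (fromℕ (i !)) (sinS i))))

  -- With φ the coefficients i! [xⁱ] Φ(x), this is p! q! [xᵖ yᵠ] Φ(x) sec(x + y).
  mul-sec[x+y] : (ℕ → ℚ) → ℕ → ℕ → ℚ
  mul-sec[x+y] φ p q = Σ[ i + j ≡ p ] fromℕ (binomial i j) * (φ i * egfCoeff secS (j ℕ.+ q))

  mul-sec[x+y]-cong : ∀ {φ ψ} p q → φ ≗ ψ → mul-sec[x+y] φ p q ≡ mul-sec[x+y] ψ p q
  mul-sec[x+y]-cong p q φ≗ψ =
    Σ₂-cong p (λ i j → cong (λ z → fromℕ (binomial i j) * (z * egfCoeff secS (j ℕ.+ q))) (φ≗ψ i))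

  mul-sec[x+y]-neg : ∀ φ p q → mul-sec[x+y] (λ i → - φ i) p q ≡ - mul-sec[x+y] φ p q
  mul-sec[x+y]-neg φ p q = begin
    mul-sec[x+y] (λ i → - φ i) p q
      ≡⟨ Σ₂-cong p (λ i j → solve 3 (λ c x y → c :* ((:- x) :* y) := con (- 1ℚ) :* (c :* (x :* y)))
                                    refl (fromℕ (binomial i j)) (φ i) (egfCoeff secS (j ℕ.+ q))) ⟩
    (Σ[ i + j ≡ p ] - 1ℚ * (fromℕ (binomial i j) * (φ i * egfCoeff secS (j ℕ.+ q))))
      ≡⟨ *-distribˡ-Σ₂ p (- 1ℚ) _ ⟨
    - 1ℚ * mul-sec[x+y] φ p q
      ≡⟨ solve 1 (λ x → con (- 1ℚ) :* x := :- x) refl (mul-sec[x+y] φ p q) ⟩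
    - mul-sec[x+y] φ p q ∎

  Σ₂-binomial-suc : ∀ p (G : ℕ → ℕ → ℚ) → (Σ[ i + j ≡ suc p ] fromℕ (binomial i j) * G i j)
                    ≡ (Σ[ i + j ≡ p ] fromℕ (binomial i j) * G (suc i) j)
                      + (Σ[ i + j ≡ p ] fromℕ (binomial i j) * G i (suc j))
  Σ₂-binomial-suc p G = begin
    (Σ[ i + j ≡ suc p ] fromℕ (binomial i j) * G i j)
      ≡⟨ Σ₂-cong-≡ (suc p) pascal ⟩
    (Σ[ i + j ≡ suc p ] (left i j + right i j))
      ≡⟨ Σ₂-distrib-+ (suc p) left right ⟩
    Σ₂ (suc p) left + Σ₂ (suc p) right
      ≡⟨ cong₂ _+_ (ℚP.+-identityˡ (Σ[ i + j ≡ p ] fromℕ (binomial i j) * G (suc i) j))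
                   (trans (Σ₂-snoc p right) (ℚP.+-identityʳ (Σ[ i + j ≡ p ] right i (suc j)))) ⟩
    (Σ[ i + j ≡ p ] fromℕ (binomial i j) * G (suc i) j) + (Σ[ i + j ≡ p ] fromℕ (binomial i j) * G i (suc j)) ∎
    where
    left right : ℕ → ℕ → ℚ
    left zero    j = 0ℚ
    left (suc i) j = fromℕ (binomial i j) * G (suc i) j
    right i zero    = 0ℚ
    right i (suc j) = fromℕ (binomial i j) * G i (suc j)
    pascal : ∀ i j → i ℕ.+ j ≡ suc p → fromℕ (binomial i j) * G i j ≡ left i j + right i j
    pascal zero    zero    ()
    pascal zero    (suc j) _ = sym (ℚP.+-identityˡ _)
    pascal (suc i) zero    _ = trans (cong (λ b → fromℕ b * G (suc i) 0) (binomial-zeroʳ i)) (sym (ℚP.+-identityʳ _))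
      where
      binomial-zeroʳ : ∀ i → 1 ≡ binomial i 0
      binomial-zeroʳ zero    = refl
      binomial-zeroʳ (suc i) = refl
    pascal (suc i) (suc j) _ =
      trans (cong (_* G (suc i) (suc j)) (fromℕ-homo-+ (binomial i (suc j)) (binomial (suc i) j)))
            (ℚP.*-distribʳ-+ (G (suc i) (suc j)) (fromℕ (binomial i (suc j))) (fromℕ (binomial (suc i) j)))

  mul-sec[x+y]-suc : ∀ φ p q → mul-sec[x+y] φ (suc p) q ≡ mul-sec[x+y] (φ ∘ suc) p q + mul-sec[x+y] φ p (suc q)
  mul-sec[x+y]-suc φ p q = trans (Σ₂-binomial-suc p (λ i j → φ i * egfCoeff secS (j ℕ.+ q)))
    (cong (mul-sec[x+y] (φ ∘ suc) p q +_)
          (Σ₂-cong p (λ i j → cong (λ k → fromℕ (binomial i j) * (φ i * egfCoeff secS k)) (sym (ℕP.+-suc j q)))))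

  -- p! q! [xᵖ yᵠ] (cos x + sin y) / cos (x + y)
  entringerSeries : ℕ → ℕ → ℚ
  entringerSeries p q = mul-sec[x+y] (egfCoeff cosS) p q + mul-sec[x+y] (egfCoeff sinS) q p

  mul-sec[x+y]-zero : ∀ φ f n → φ ≗ egfCoeff f → mul-sec[x+y] φ n 0 ≡ fromℕ (n !) * (f ⊛ secS) n
  mul-sec[x+y]-zero φ f n φ≗f = begin
    mul-sec[x+y] φ n 0
      ≡⟨ Σ₂-cong n (λ i j → cong₂ (λ z k → fromℕ (binomial i j) * (z * egfCoeff secS k)) (φ≗f i) (ℕP.+-identityʳ j)) ⟩
    (Σ[ i + j ≡ n ] fromℕ (binomial i j) * (egfCoeff f i * egfCoeff secS j))
      ≡⟨ !-*-⊛ f secS n ⟨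
    fromℕ (n !) * (f ⊛ secS) n ∎

  entringerSeries-isBoustrophedon : IsBoustrophedon entringerSeries
  entringerSeries-isBoustrophedon = record { step = step ; edge = edge }
    where
    C S : ℕ → ℕ → ℚ
    C = mul-sec[x+y] (egfCoeff cosS)
    S = mul-sec[x+y] (egfCoeff sinS)
    step : ∀ p q → entringerSeries p (suc q) ≡ entringerSeries (suc p) q + entringerSeries q p
    step p q = begin
      C p (suc q) + S (suc q) p
        ≡⟨ cong (C p (suc q) +_) (trans (mul-sec[x+y]-suc (egfCoeff sinS) q p)
                                        (cong (_+ S q (suc p)) (mul-sec[x+y]-cong q p egfCoeff-sinS-suc))) ⟩
      C p (suc q) + (C q p + S q (suc p))
        ≡⟨ solve 4 (λ a b c d → a :+ (b :+ c) := (((:- d) :+ a) :+ c) :+ (b :+ d))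
                   refl (C p (suc q)) (C q p) (S q (suc p)) (S p q) ⟩
      ((- S p q + C p (suc q)) + S q (suc p)) + (C q p + S p q)
        ≡⟨ cong (λ z → ((z + C p (suc q)) + S q (suc p)) + (C q p + S p q))
                (trans (mul-sec[x+y]-cong p q egfCoeff-cosS-suc) (mul-sec[x+y]-neg (egfCoeff sinS) p q)) ⟨
      ((mul-sec[x+y] (egfCoeff cosS ∘ suc) p q + C p (suc q)) + S q (suc p)) + (C q p + S p q)
        ≡⟨ cong (λ z → (z + S q (suc p)) + (C q p + S p q)) (mul-sec[x+y]-suc (egfCoeff cosS) p q) ⟨
      entringerSeries (suc p) q + entringerSeries q p ∎
    edge : ∀ p → entringerSeries (suc p) 0 ≡ 0ℚ
    edge p = begin
      C (suc p) 0 + S 0 (suc p)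
        ≡⟨ cong (_+ S 0 (suc p)) (mul-sec[x+y]-zero _ cosS (suc p) (λ _ → refl)) ⟩
      fromℕ (suc p !) * (cosS ⊛ secS) (suc p) + S 0 (suc p)
        ≡⟨ cong (λ z → fromℕ (suc p !) * z + S 0 (suc p)) (cosS-⊛-secS (suc p)) ⟩
      fromℕ (suc p !) * 0ℚ + S 0 (suc p)
        ≡⟨ solve 2 (λ a s → a :* con 0ℚ :+ con 1ℚ :* (con 0ℚ :* s) := con 0ℚ)
                refl (fromℕ (suc p !)) (egfCoeff secS (suc p)) ⟩
      0ℚ ∎

  entringerSeries-zero : ∀ n → entringerSeries 0 n ≡ fromℕ (n !) * (secS ⊕ tanS) n
  entringerSeries-zero n = begin
    mul-sec[x+y] (egfCoeff cosS) 0 n + mul-sec[x+y] (egfCoeff sinS) n 0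
      ≡⟨ cong₂ _+_ (solve 1 (λ s → con 1ℚ :* (con 1ℚ :* s) := s) refl (egfCoeff secS n))
                   (mul-sec[x+y]-zero _ sinS n (λ _ → refl)) ⟩
    egfCoeff secS n + fromℕ (n !) * tanS n
      ≡⟨ ℚP.*-distribˡ-+ (fromℕ (n !)) (secS n) (tanS n) ⟨
    fromℕ (n !) * (secS ⊕ tanS) n ∎

module Combinatorial where

  open import Data.Nat using (_+_; _*_)
  open import Data.Nat.Properties using (_<?_; _≤?_; _≟_)
  open import Data.Nat.Tactic.RingSolver using (solve-∀)
  open import Data.List using (List; []; _∷_; map; concatMap; filter; length; upTo; applyUpTo; _++_)
  open import Data.List.Relation.Unary.Unique.DecPropositional ℕ._≟_ using (unique?)
  open import Data.List.Relation.Unary.All using (All; all?)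
  open import Data.Bool using (true; false; _∧_; if_then_else_)
  open import Data.Empty using (⊥-elim)
  open import Data.Product using (_×_; _,_)
  open import Relation.Nullary using (Dec; yes; no; does; ¬_)
  open import Relation.Nullary.Decidable using (_×-dec_; ¬?)
  open import Relation.Binary.Definitions using (tri<; tri≈; tri>)

  open FiniteSums ℕP.+-*-isCommutativeSemiring
  open ≡-Reasoning

  𝟙 : ∀ {A : Set} → Dec A → ℕ
  𝟙 d = if does d then 1 else 0

  𝟙-× : ∀ {A B : Set} (d : Dec A) (e : Dec B) → 𝟙 (d ×-dec e) ≡ 𝟙 d * 𝟙 e
  𝟙-× d e = by-cases (does d) (does e)
    where
    by-cases : ∀ a b → (if a ∧ b then 1 else 0) ≡ (if a then 1 else 0) * (if b then 1 else 0)
    by-cases true  b = sym (ℕP.+-identityʳ _)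
    by-cases false b = refl

  𝟙-⇔ : ∀ {A B : Set} (d : Dec A) (e : Dec B) → (A → B) → (B → A) → 𝟙 d ≡ 𝟙 e
  𝟙-⇔ (yes a) (yes b) A→B B→A = refl
  𝟙-⇔ (yes a) (no ¬b) A→B B→A = ⊥-elim (¬b (A→B a))
  𝟙-⇔ (no ¬a) (yes b) A→B B→A = ⊥-elim (¬a (B→A b))
  𝟙-⇔ (no ¬a) (no ¬b) A→B B→A = refl

  𝟙-yes : ∀ {A : Set} (d : Dec A) → A → 𝟙 d ≡ 1
  𝟙-yes (yes a) _ = refl
  𝟙-yes (no ¬a) a = ⊥-elim (¬a a)

  𝟙-no : ∀ {A : Set} (d : Dec A) → ¬ A → 𝟙 d ≡ 0
  𝟙-no (yes a) ¬a = ⊥-elim (¬a a)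
  𝟙-no (no _)  _  = refl

  -- Sums over words and permutations

  sumOver : ∀ {A : Set} → List A → (A → ℕ) → ℕ
  sumOver []       g = 0
  sumOver (x ∷ xs) g = g x + sumOver xs g

  infix 2 sumOver
  syntax sumOver xs (λ x → e) = Σ[ x ∈ xs ] e

  sumOver-cong : ∀ {A : Set} (xs : List A) {g h : A → ℕ} → (∀ x → g x ≡ h x) → sumOver xs g ≡ sumOver xs h
  sumOver-cong []       g≗h = refl
  sumOver-cong (x ∷ xs) g≗h = cong₂ _+_ (g≗h x) (sumOver-cong xs g≗h)

  sumOver-++ : ∀ {A : Set} (xs ys : List A) g → sumOver (xs ++ ys) g ≡ sumOver xs g + sumOver ys g
  sumOver-++ []       ys g = refl
  sumOver-++ (x ∷ xs) ys g = trans (cong (g x +_) (sumOver-++ xs ys g)) (sym (ℕP.+-assoc (g x) _ _))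

  sumOver-concatMap : ∀ {A B : Set} (xs : List A) (f : A → List B) g →
                      sumOver (concatMap f xs) g ≡ (Σ[ x ∈ xs ] sumOver (f x) g)
  sumOver-concatMap []       f g = refl
  sumOver-concatMap (x ∷ xs) f g =
    trans (sumOver-++ (f x) (concatMap f xs) g) (cong (sumOver (f x) g +_) (sumOver-concatMap xs f g))

  sumOver-map : ∀ {A B : Set} (xs : List A) (f : A → B) g → sumOver (map f xs) g ≡ sumOver xs (g ∘ f)
  sumOver-map []       f g = refl
  sumOver-map (x ∷ xs) f g = cong (g (f x) +_) (sumOver-map xs f g)

  sumOver-applyUpTo : ∀ (f : ℕ → ℕ) n g → sumOver (applyUpTo f n) g ≡ Σ< n (g ∘ f)
  sumOver-applyUpTo f zero    g = refl
  sumOver-applyUpTo f (suc n) g = cong (g (f 0) +_) (sumOver-applyUpTo (f ∘ suc) n g)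

  *-distribˡ-sumOver : ∀ {A : Set} (xs : List A) c g → c * sumOver xs g ≡ (Σ[ x ∈ xs ] c * g x)
  *-distribˡ-sumOver []       c g = ℕP.*-zeroʳ c
  *-distribˡ-sumOver (x ∷ xs) c g = trans (ℕP.*-distribˡ-+ c (g x) _) (cong (c * g x +_) (*-distribˡ-sumOver xs c g))

  sumOver-Σ-comm : ∀ {A : Set} (xs : List A) m (G : ℕ → A → ℕ) →
                   (Σ[ x ∈ xs ] Σ[ i < m ] G i x) ≡ (Σ[ i < m ] Σ[ x ∈ xs ] G i x)
  sumOver-Σ-comm []       m G = sym (Σ-0 m (λ _ _ → refl))
  sumOver-Σ-comm (x ∷ xs) m G = trans (cong (Σ< m (λ i → G i x) +_) (sumOver-Σ-comm xs m G))
                                      (sym (Σ-distrib-+ m (λ i → G i x) (λ i → sumOver xs (G i))))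

  length-filter : ∀ {A : Set} {P : A → Set} (P? : ∀ x → Dec (P x)) xs → length (filter P? xs) ≡ (Σ[ x ∈ xs ] 𝟙 (P? x))
  length-filter P? []       = refl
  length-filter P? (x ∷ xs) with does (P? x)
  ... | true  = cong suc (length-filter P? xs)
  ... | false = length-filter P? xs

  sumOver-filter : ∀ {A : Set} {P : A → Set} (P? : ∀ x → Dec (P x)) xs g →
                   sumOver (filter P? xs) g ≡ (Σ[ x ∈ xs ] 𝟙 (P? x) * g x)
  sumOver-filter P? []       g = refl
  sumOver-filter P? (x ∷ xs) g with does (P? x)
  ... | true  = cong₂ _+_ (sym (ℕP.+-identityʳ (g x))) (sumOver-filter P? xs g)
  ... | false = sumOver-filter P? xs g

  sumOver-words-suc : ∀ n k g → (Σ[ w ∈ words n (suc k) ] g w) ≡ (Σ[ w ∈ words n k ] Σ[ i < n ] g (suc i ∷ w))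
  sumOver-words-suc n k g = trans (sumOver-concatMap (words n k) _ g) (sumOver-cong (words n k) (λ w → begin
    sumOver (map (λ a → a ∷ w) (map suc (upTo n))) g  ≡⟨ sumOver-map (map suc (upTo n)) (λ a → a ∷ w) g ⟩
    sumOver (map suc (upTo n)) (λ a → g (a ∷ w))      ≡⟨ sumOver-map (upTo n) suc (λ a → g (a ∷ w)) ⟩
    sumOver (upTo n) (λ i → g (suc i ∷ w))            ≡⟨ sumOver-applyUpTo (λ i → i) n (λ i → g (suc i ∷ w)) ⟩
    (Σ[ i < n ] g (suc i ∷ w))                        ∎))

  punchIn : ℕ → ℕ → ℕ
  punchIn zero    x       = suc x
  punchIn (suc a) zero    = zero
  punchIn (suc a) (suc x) = suc (punchIn a x)

  punchIn-mono-< : ∀ a {x y} → x < y → punchIn a x < punchIn a y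
  punchIn-mono-< zero                    x<y       = s≤s x<y
  punchIn-mono-< (suc a) {zero}  {suc y} _         = s≤s z≤n
  punchIn-mono-< (suc a) {suc x} {suc y} (s≤s x<y) = s≤s (punchIn-mono-< a x<y)

  punchIn-cancel-< : ∀ a {x y} → punchIn a x < punchIn a y → x < y
  punchIn-cancel-< zero                    (s≤s x<y) = x<y
  punchIn-cancel-< (suc a) {zero}  {zero}  ()
  punchIn-cancel-< (suc a) {zero}  {suc y} _         = s≤s z≤n
  punchIn-cancel-< (suc a) {suc x} {zero}  ()
  punchIn-cancel-< (suc a) {suc x} {suc y} (s≤s x<y) = s≤s (punchIn-cancel-< a x<y)

  punchIn-injective : ∀ a {x y} → punchIn a x ≡ punchIn a y → x ≡ y
  punchIn-injective zero                    eq = ℕP.suc-injective eq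
  punchIn-injective (suc a) {zero}  {zero}  _  = refl
  punchIn-injective (suc a) {suc x} {suc y} eq = cong suc (punchIn-injective a (ℕP.suc-injective eq))

  punchIn-< : ∀ a {x} → x < a → punchIn a x ≡ x
  punchIn-< (suc a) {zero}  _         = refl
  punchIn-< (suc a) {suc x} (s≤s x<a) = cong suc (punchIn-< a x<a)

  punchIn-≥ : ∀ a {x} → a ≤ x → punchIn a x ≡ suc x
  punchIn-≥ zero    _         = refl
  punchIn-≥ (suc a) {suc x} (s≤s a≤x) = cong suc (punchIn-≥ a a≤x)

  <-punchIn⇒≤ : ∀ a x → a < punchIn a x → a ≤ x
  <-punchIn⇒≤ zero    x       _         = z≤n
  <-punchIn⇒≤ (suc a) (suc x) (s≤s a<x) = s≤s (<-punchIn⇒≤ a x a<x)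

  ≤⇒<-punchIn : ∀ a x → a ≤ x → a < punchIn a x
  ≤⇒<-punchIn a x a≤x = subst (a <_) (sym (punchIn-≥ a a≤x)) (s≤s a≤x)

  punchIn-<⇒< : ∀ a x → punchIn a x < a → x < a
  punchIn-<⇒< (suc a) zero    _         = s≤s z≤n
  punchIn-<⇒< (suc a) (suc x) (s≤s x<a) = s≤s (punchIn-<⇒< a x x<a)

  <⇒punchIn-< : ∀ a x → x < a → punchIn a x < a
  <⇒punchIn-< a x x<a = subst (_< a) (sym (punchIn-< a x<a)) x<a

  mutual
    𝟙-altUp-punchIn : ∀ a w → 𝟙 (altUp? (map (punchIn a) w)) ≡ 𝟙 (altUp? w)
    𝟙-altUp-punchIn a []          = refl
    𝟙-altUp-punchIn a (x ∷ [])    = refl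
    𝟙-altUp-punchIn a (x ∷ y ∷ r) = begin
      𝟙 ((punchIn a x <? punchIn a y) ×-dec altDown? (map (punchIn a) (y ∷ r)))
        ≡⟨ 𝟙-× (punchIn a x <? punchIn a y) (altDown? (map (punchIn a) (y ∷ r))) ⟩
      𝟙 (punchIn a x <? punchIn a y) * 𝟙 (altDown? (map (punchIn a) (y ∷ r)))
        ≡⟨ cong₂ _*_ (𝟙-⇔ (punchIn a x <? punchIn a y) (x <? y) (punchIn-cancel-< a) (punchIn-mono-< a))
                     (𝟙-altDown-punchIn a (y ∷ r)) ⟩
      𝟙 (x <? y) * 𝟙 (altDown? (y ∷ r))
        ≡⟨ 𝟙-× (x <? y) (altDown? (y ∷ r)) ⟨
      𝟙 (altUp? (x ∷ y ∷ r)) ∎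

    𝟙-altDown-punchIn : ∀ a w → 𝟙 (altDown? (map (punchIn a) w)) ≡ 𝟙 (altDown? w)
    𝟙-altDown-punchIn a []          = refl
    𝟙-altDown-punchIn a (x ∷ [])    = refl
    𝟙-altDown-punchIn a (x ∷ y ∷ r) = begin
      𝟙 ((punchIn a y <? punchIn a x) ×-dec altUp? (map (punchIn a) (y ∷ r)))
        ≡⟨ 𝟙-× (punchIn a y <? punchIn a x) (altUp? (map (punchIn a) (y ∷ r))) ⟩
      𝟙 (punchIn a y <? punchIn a x) * 𝟙 (altUp? (map (punchIn a) (y ∷ r)))
        ≡⟨ cong₂ _*_ (𝟙-⇔ (punchIn a y <? punchIn a x) (y <? x) (punchIn-cancel-< a) (punchIn-mono-< a))
                     (𝟙-altUp-punchIn a (y ∷ r)) ⟩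
      𝟙 (y <? x) * 𝟙 (altUp? (y ∷ r))
        ≡⟨ 𝟙-× (y <? x) (altUp? (y ∷ r)) ⟨
      𝟙 (altDown? (x ∷ y ∷ r)) ∎

  _∉?_ : ∀ a w → Dec (All (λ y → ¬ a ≡ y) w)
  a ∉? w = all? (λ y → ¬? (a ≟ y)) w

  𝟙-∉-punchIn : ∀ a x w → 𝟙 (punchIn a x ∉? map (punchIn a) w) ≡ 𝟙 (x ∉? w)
  𝟙-∉-punchIn a x []      = refl
  𝟙-∉-punchIn a x (y ∷ w) = begin
    𝟙 (punchIn a x ∉? (punchIn a y ∷ map (punchIn a) w))
      ≡⟨ 𝟙-× (¬? (punchIn a x ≟ punchIn a y)) (punchIn a x ∉? map (punchIn a) w) ⟩
    𝟙 (¬? (punchIn a x ≟ punchIn a y)) * 𝟙 (punchIn a x ∉? map (punchIn a) w)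
      ≡⟨ cong₂ _*_ (𝟙-⇔ (¬? (punchIn a x ≟ punchIn a y)) (¬? (x ≟ y)) (λ x≢y → x≢y ∘ cong (punchIn a))
                                                                      (λ x≢y → x≢y ∘ punchIn-injective a))
                   (𝟙-∉-punchIn a x w) ⟩
    𝟙 (¬? (x ≟ y)) * 𝟙 (x ∉? w)
      ≡⟨ 𝟙-× (¬? (x ≟ y)) (x ∉? w) ⟨
    𝟙 (x ∉? (y ∷ w)) ∎

  𝟙-unique-punchIn : ∀ a w → 𝟙 (unique? (map (punchIn a) w)) ≡ 𝟙 (unique? w)
  𝟙-unique-punchIn a []      = refl
  𝟙-unique-punchIn a (x ∷ w) = begin
    𝟙 (unique? (punchIn a x ∷ map (punchIn a) w))
      ≡⟨ 𝟙-× (punchIn a x ∉? map (punchIn a) w) (unique? (map (punchIn a) w)) ⟩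
    𝟙 (punchIn a x ∉? map (punchIn a) w) * 𝟙 (unique? (map (punchIn a) w))
      ≡⟨ cong₂ _*_ (𝟙-∉-punchIn a x w) (𝟙-unique-punchIn a w) ⟩
    𝟙 (x ∉? w) * 𝟙 (unique? w)
      ≡⟨ 𝟙-× (x ∉? w) (unique? w) ⟨
    𝟙 (unique? (x ∷ w)) ∎

  Σ-≢-punchIn : ∀ a m (H : ℕ → ℕ) → a ≤ m → (Σ[ i < suc m ] 𝟙 (¬? (a ≟ i)) * H i) ≡ (Σ[ i < m ] H (punchIn a i))
  Σ-≢-punchIn zero    m       H _         = Σ-cong m (λ i → ℕP.*-identityˡ (H (suc i)))
  Σ-≢-punchIn (suc a) (suc m) H (s≤s a≤m) = cong₂ _+_ (ℕP.*-identityˡ (H 0)) (Σ-≢-punchIn a m (H ∘ suc) a≤m)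

  -- Words over {1, …, m + 1} avoiding the letter a + 1 are the images under punchIn (a + 1)
  -- of the words over {1, …, m}.
  sumOver-words-∉ : ∀ m a → a ≤ m → ∀ k (G : List ℕ → ℕ) →
                    (Σ[ w ∈ words (suc m) k ] 𝟙 (suc a ∉? w) * G w) ≡ (Σ[ w ∈ words m k ] G (map (punchIn (suc a)) w))
  sumOver-words-∉ m a a≤m zero    G = cong (_+ 0) (ℕP.*-identityˡ (G []))
  sumOver-words-∉ m a a≤m (suc k) G = begin
    (Σ[ w ∈ words (suc m) (suc k) ] 𝟙 (A ∉? w) * G w)
      ≡⟨ sumOver-words-suc (suc m) k (λ w → 𝟙 (A ∉? w) * G w) ⟩
    (Σ[ w ∈ words (suc m) k ] Σ[ i < suc m ] 𝟙 (A ∉? (suc i ∷ w)) * G (suc i ∷ w))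
      ≡⟨ sumOver-cong (words (suc m) k) factor ⟩
    (Σ[ w ∈ words (suc m) k ] 𝟙 (A ∉? w) * G′ w)
      ≡⟨ sumOver-words-∉ m a a≤m k G′ ⟩
    (Σ[ w ∈ words m k ] G′ (map (punchIn A) w))
      ≡⟨ sumOver-cong (words m k) (λ w → Σ-≢-punchIn a m (λ i → G (suc i ∷ map (punchIn A) w)) a≤m) ⟩
    (Σ[ w ∈ words m k ] Σ[ i < m ] G (suc (punchIn a i) ∷ map (punchIn A) w))
      ≡⟨ sumOver-words-suc m k (λ w → G (map (punchIn A) w)) ⟨
    (Σ[ w ∈ words m (suc k) ] G (map (punchIn A) w)) ∎
    where
    A : ℕ
    A = suc a
    G′ : List ℕ → ℕ
    G′ w = Σ[ i < suc m ] 𝟙 (¬? (a ≟ i)) * G (suc i ∷ w)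
    factor : ∀ w → (Σ[ i < suc m ] 𝟙 (A ∉? (suc i ∷ w)) * G (suc i ∷ w)) ≡ 𝟙 (A ∉? w) * G′ w
    factor w = begin
      (Σ[ i < suc m ] 𝟙 (A ∉? (suc i ∷ w)) * G (suc i ∷ w))
        ≡⟨ Σ-cong (suc m) (λ i → trans (cong (_* G (suc i ∷ w)) (𝟙-× (¬? (A ≟ suc i)) (A ∉? w)))
                                       (regroup (𝟙 (¬? (a ≟ i))) (𝟙 (A ∉? w)) (G (suc i ∷ w)))) ⟩
      (Σ[ i < suc m ] 𝟙 (A ∉? w) * (𝟙 (¬? (a ≟ i)) * G (suc i ∷ w)))
        ≡⟨ *-distribˡ-Σ (suc m) (𝟙 (A ∉? w)) (λ i → 𝟙 (¬? (a ≟ i)) * G (suc i ∷ w)) ⟨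
      𝟙 (A ∉? w) * G′ w ∎
      where
      regroup : ∀ x y z → (x * y) * z ≡ y * (x * z)
      regroup = solve-∀

  sumPerms : ℕ → (List ℕ → ℕ) → ℕ
  sumPerms m h = Σ[ w ∈ words m m ] 𝟙 (unique? w) * h w

  -- i ◁ w starts with the letter i + 1, followed by the letters of w in the same relative order.
  infixr 5 _◁_
  _◁_ : ℕ → List ℕ → List ℕ
  i ◁ w = suc i ∷ map (punchIn (suc i)) w

  sumPerms-suc : ∀ m h → sumPerms (suc m) h ≡ (Σ[ i < suc m ] sumPerms m (λ w → h (i ◁ w)))
  sumPerms-suc m h = begin
    (Σ[ w ∈ words (suc m) (suc m) ] 𝟙 (unique? w) * h w)
      ≡⟨ sumOver-words-suc (suc m) m (λ w → 𝟙 (unique? w) * h w) ⟩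
    (Σ[ w ∈ words (suc m) m ] Σ[ i < suc m ] 𝟙 (unique? (suc i ∷ w)) * h (suc i ∷ w))
      ≡⟨ sumOver-cong (words (suc m) m) (λ w → Σ-cong (suc m) (λ i →
           trans (cong (_* h (suc i ∷ w)) (𝟙-× (suc i ∉? w) (unique? w))) (ℕP.*-assoc (𝟙 (suc i ∉? w)) _ _))) ⟩
    (Σ[ w ∈ words (suc m) m ] Σ[ i < suc m ] 𝟙 (suc i ∉? w) * (𝟙 (unique? w) * h (suc i ∷ w)))
      ≡⟨ sumOver-Σ-comm (words (suc m) m) (suc m) (λ i w → 𝟙 (suc i ∉? w) * (𝟙 (unique? w) * h (suc i ∷ w))) ⟩
    (Σ[ i < suc m ] Σ[ w ∈ words (suc m) m ] 𝟙 (suc i ∉? w) * (𝟙 (unique? w) * h (suc i ∷ w)))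
      ≡⟨ Σ-cong-< (suc m) (λ i i<1+m →
           sumOver-words-∉ m i (ℕP.≤-pred i<1+m) m (λ w → 𝟙 (unique? w) * h (suc i ∷ w))) ⟩
    (Σ[ i < suc m ] Σ[ w ∈ words m m ] 𝟙 (unique? (map (punchIn (suc i)) w)) * h (i ◁ w))
      ≡⟨ Σ-cong (suc m) (λ i → sumOver-cong (words m m) (λ w → cong (_* h (i ◁ w)) (𝟙-unique-punchIn (suc i) w))) ⟩
    (Σ[ i < suc m ] sumPerms m (λ w → h (i ◁ w))) ∎

  sumPerms-*ˡ : ∀ m c g → sumPerms m (λ w → c * g w) ≡ c * sumPerms m g
  sumPerms-*ˡ m c g = begin
    (Σ[ w ∈ words m m ] 𝟙 (unique? w) * (c * g w))
      ≡⟨ sumOver-cong (words m m) (λ w → regroup (𝟙 (unique? w)) c (g w)) ⟩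
    (Σ[ w ∈ words m m ] c * (𝟙 (unique? w) * g w))
      ≡⟨ *-distribˡ-sumOver (words m m) c (λ w → 𝟙 (unique? w) * g w) ⟨
    c * sumPerms m g ∎
    where
    regroup : ∀ u c g → u * (c * g) ≡ c * (u * g)
    regroup = solve-∀

  sumPerms-cong : ∀ m {g h} → (∀ w → g w ≡ h w) → sumPerms m g ≡ sumPerms m h
  sumPerms-cong m g≗h = sumOver-cong (words m m) (λ w → cong (𝟙 (unique? w) *_) (g≗h w))

  countAltGap2≡sumPerms : ∀ n → countAltGap2 n ≡ sumPerms n (λ w → 𝟙 (altUp? w) * 𝟙 (gap2? w))
  countAltGap2≡sumPerms n = begin
    length (filter P? (filter unique? (words n n)))        ≡⟨ length-filter P? (filter unique? (words n n)) ⟩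
    (Σ[ w ∈ filter unique? (words n n) ] 𝟙 (P? w))          ≡⟨ sumOver-filter unique? (words n n) (λ w → 𝟙 (P? w)) ⟩
    sumPerms n (λ w → 𝟙 (P? w))                            ≡⟨ sumPerms-cong n (λ w → 𝟙-× (altUp? w) (gap2? w)) ⟩
    sumPerms n (λ w → 𝟙 (altUp? w) * 𝟙 (gap2? w))          ∎
    where
    P? : ∀ w → Dec (AltUp w × Gap2 w)
    P? w = altUp? w ×-dec gap2? w

  -- Entringer numbers

  -- startUp m i (startDown m i) counts the permutations of {1, …, m + 1} that start with i + 1 and
  -- alternate beginning with an ascent (a descent).
  startUp startDown : ℕ → ℕ → ℕ
  startUp   m i = sumPerms m (λ w → 𝟙 (altUp?   (i ◁ w)))
  startDown m i = sumPerms m (λ w → 𝟙 (altDown? (i ◁ w)))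

  𝟙-altUp-◁◁ : ∀ p i w → 𝟙 (altUp? (p ◁ i ◁ w)) ≡ 𝟙 (p ≤? i) * 𝟙 (altDown? (i ◁ w))
  𝟙-altUp-◁◁ p i w = trans (𝟙-× (suc p <? punchIn (suc p) (suc i)) (altDown? (map (punchIn (suc p)) (i ◁ w))))
    (cong₂ _*_ (𝟙-⇔ (suc p <? punchIn (suc p) (suc i)) (p ≤? i) (ℕP.≤-pred ∘ <-punchIn⇒≤ (suc p) (suc i))
                                                                (≤⇒<-punchIn (suc p) (suc i) ∘ s≤s))
               (𝟙-altDown-punchIn (suc p) (i ◁ w)))

  𝟙-altDown-◁◁ : ∀ p i w → 𝟙 (altDown? (p ◁ i ◁ w)) ≡ 𝟙 (i <? p) * 𝟙 (altUp? (i ◁ w))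
  𝟙-altDown-◁◁ p i w = trans (𝟙-× (punchIn (suc p) (suc i) <? suc p) (altUp? (map (punchIn (suc p)) (i ◁ w))))
    (cong₂ _*_ (𝟙-⇔ (punchIn (suc p) (suc i) <? suc p) (i <? p) (ℕP.≤-pred ∘ punchIn-<⇒< (suc p) (suc i))
                                                                (<⇒punchIn-< (suc p) (suc i) ∘ s≤s))
               (𝟙-altUp-punchIn (suc p) (i ◁ w)))

  startUp-suc : ∀ m p → startUp (suc m) p ≡ (Σ[ i < suc m ] 𝟙 (p ≤? i) * startDown m i)
  startUp-suc m p = begin
    startUp (suc m) p
      ≡⟨ sumPerms-suc m (λ w → 𝟙 (altUp? (p ◁ w))) ⟩
    (Σ[ i < suc m ] sumPerms m (λ w → 𝟙 (altUp? (p ◁ i ◁ w))))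
      ≡⟨ Σ-cong (suc m) (λ i → trans (sumPerms-cong m (𝟙-altUp-◁◁ p i)) (sumPerms-*ˡ m (𝟙 (p ≤? i)) _)) ⟩
    (Σ[ i < suc m ] 𝟙 (p ≤? i) * startDown m i) ∎

  startDown-suc : ∀ m p → startDown (suc m) p ≡ (Σ[ i < suc m ] 𝟙 (i <? p) * startUp m i)
  startDown-suc m p = begin
    startDown (suc m) p
      ≡⟨ sumPerms-suc m (λ w → 𝟙 (altDown? (p ◁ w))) ⟩
    (Σ[ i < suc m ] sumPerms m (λ w → 𝟙 (altDown? (p ◁ i ◁ w))))
      ≡⟨ Σ-cong (suc m) (λ i → trans (sumPerms-cong m (𝟙-altDown-◁◁ p i)) (sumPerms-*ˡ m (𝟙 (i <? p)) _)) ⟩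
    (Σ[ i < suc m ] 𝟙 (i <? p) * startUp m i) ∎

  startUp≡startDown-complement : ∀ m p → p ≤ m → startUp m p ≡ startDown m (m ∸ p)
  startUp≡startDown-complement zero    zero    z≤n = refl
  startUp≡startDown-complement (suc m) p       p≤1+m = begin
    startUp (suc m) p
      ≡⟨ startUp-suc m p ⟩
    (Σ[ i < suc m ] 𝟙 (p ≤? i) * startDown m i)
      ≡⟨ Σ-cong-< (suc m) (λ i i<1+m → cong (𝟙 (p ≤? i) *_) (startDown≡startUp (ℕP.≤-pred i<1+m))) ⟩
    (Σ[ i < suc m ] 𝟙 (p ≤? i) * startUp m (m ∸ i))
      ≡⟨ Σ-reverse m (λ i → 𝟙 (p ≤? i) * startUp m (m ∸ i)) ⟩
    (Σ[ i < suc m ] 𝟙 (p ≤? m ∸ i) * startUp m (m ∸ (m ∸ i)))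
      ≡⟨ Σ-cong-< (suc m) (λ i i<1+m → cong₂ _*_ (reflected-condition (ℕP.≤-pred i<1+m))
                                                 (cong (startUp m) (ℕP.m∸[m∸n]≡n (ℕP.≤-pred i<1+m)))) ⟩
    (Σ[ i < suc m ] 𝟙 (i <? suc m ∸ p) * startUp m i)
      ≡⟨ startDown-suc m (suc m ∸ p) ⟨
    startDown (suc m) (suc m ∸ p) ∎
    where
    startDown≡startUp : ∀ {i} → i ≤ m → startDown m i ≡ startUp m (m ∸ i)
    startDown≡startUp {i} i≤m = sym (trans (startUp≡startDown-complement m (m ∸ i) (ℕP.m∸n≤m m i))
                                           (cong (startDown m) (ℕP.m∸[m∸n]≡n i≤m)))
    reflected-condition : ∀ {i} → i ≤ m → 𝟙 (p ≤? m ∸ i) ≡ 𝟙 (i <? suc m ∸ p)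
    reflected-condition {i} i≤m = 𝟙-⇔ (p ≤? m ∸ i) (i <? suc m ∸ p)
      (λ p≤m∸i → ℕP.m+n≤o⇒m≤o∸n (suc i) (s≤s (subst (_≤ m) (ℕP.+-comm p i) (ℕP.m≤o∸n⇒m+n≤o p i≤m p≤m∸i))))
      (λ i<1+m∸p → ℕP.m+n≤o⇒m≤o∸n p (subst (_≤ m) (ℕP.+-comm i p) (ℕP.≤-pred (ℕP.m≤o∸n⇒m+n≤o (suc i) p≤1+m i<1+m∸p))))

  entringer : ℕ → ℕ → ℕ
  entringer p q = startUp (p + q) p

  𝟙-≤-split : ∀ p i → 𝟙 (p ≤? i) ≡ 𝟙 (p ≟ i) + 𝟙 (suc p ≤? i)
  𝟙-≤-split p i with ℕP.<-cmp p i
  ... | tri< p<i p≢i _   =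
    trans (𝟙-yes (p ≤? i) (ℕP.<⇒≤ p<i)) (sym (cong₂ _+_ (𝟙-no (p ≟ i) p≢i) (𝟙-yes (suc p ≤? i) p<i)))
  ... | tri≈ p≮i p≡i _   =
    trans (𝟙-yes (p ≤? i) (ℕP.≤-reflexive p≡i)) (sym (cong₂ _+_ (𝟙-yes (p ≟ i) p≡i) (𝟙-no (suc p ≤? i) p≮i)))
  ... | tri> p≮i p≢i p>i =
    trans (𝟙-no (p ≤? i) (ℕP.<⇒≱ p>i)) (sym (cong₂ _+_ (𝟙-no (p ≟ i) p≢i) (𝟙-no (suc p ≤? i) p≮i)))

  Σ-𝟙-≟ : ∀ n p (g : ℕ → ℕ) → p < n → (Σ[ i < n ] 𝟙 (p ≟ i) * g i) ≡ g p
  Σ-𝟙-≟ (suc n) zero    g _         =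
    trans (cong (g 0 + 0 +_) (Σ-0 n (λ _ _ → refl))) (trans (ℕP.+-identityʳ _) (ℕP.+-identityʳ (g 0)))
  Σ-𝟙-≟ (suc n) (suc p) g (s≤s p<n) = Σ-𝟙-≟ n p (g ∘ suc) p<n

  entringer-step : ∀ p q → entringer p (suc q) ≡ entringer (suc p) q + entringer q p
  entringer-step p q = begin
    startUp (p + suc q) p
      ≡⟨ cong (λ m → startUp m p) (ℕP.+-suc p q) ⟩
    startUp (suc (p + q)) p
      ≡⟨ startUp-suc (p + q) p ⟩
    (Σ[ i < suc (p + q) ] 𝟙 (p ≤? i) * D i)
      ≡⟨ Σ-cong (suc (p + q)) (λ i → trans (cong (_* D i) (𝟙-≤-split p i)) (ℕP.*-distribʳ-+ (D i) (𝟙 (p ≟ i)) _)) ⟩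
    (Σ[ i < suc (p + q) ] (𝟙 (p ≟ i) * D i + 𝟙 (suc p ≤? i) * D i))
      ≡⟨ Σ-distrib-+ (suc (p + q)) (λ i → 𝟙 (p ≟ i) * D i) (λ i → 𝟙 (suc p ≤? i) * D i) ⟩
    (Σ[ i < suc (p + q) ] 𝟙 (p ≟ i) * D i) + (Σ[ i < suc (p + q) ] 𝟙 (suc p ≤? i) * D i)
      ≡⟨ cong₂ _+_ (Σ-𝟙-≟ (suc (p + q)) p D (s≤s (ℕP.m≤m+n p q))) (sym (startUp-suc (p + q) (suc p))) ⟩
    D p + startUp (suc (p + q)) (suc p)
      ≡⟨ ℕP.+-comm (D p) _ ⟩
    entringer (suc p) q + D p
      ≡⟨ cong (entringer (suc p) q +_) D-p≡entringer ⟩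
    entringer (suc p) q + entringer q p ∎
    where
    D : ℕ → ℕ
    D = startDown (p + q)
    D-p≡entringer : startDown (p + q) p ≡ startUp (q + p) q
    D-p≡entringer = begin
      startDown (p + q) p         ≡⟨ cong (λ m → startDown m p) (ℕP.+-comm p q) ⟩
      startDown (q + p) p         ≡⟨ cong (startDown (q + p)) (ℕP.m+n∸m≡n q p) ⟨
      startDown (q + p) (q + p ∸ q) ≡⟨ startUp≡startDown-complement (q + p) q (ℕP.m≤m+n q p) ⟨
      startUp (q + p) q           ∎

  entringer-edge : ∀ p → entringer (suc p) 0 ≡ 0
  entringer-edge p = trans (startUp-suc (p + 0) (suc p)) (Σ-0 (suc (p + 0)) (λ i i<1+p+0 →
    cong (_* startDown (p + 0) i) (𝟙-no (suc p ≤? i) (λ 1+p≤i →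
      ℕP.<-irrefl refl (ℕP.≤-trans 1+p≤i (subst (i ≤_) (ℕP.+-identityʳ p) (ℕP.≤-pred i<1+p+0)))))))

  -- The gap condition

  -- Before v + 1 is inserted, the second and third letters of v ◁ j ◁ k ◁ ρ are j + 1 and punchIn (j + 1) (k + 1).
  𝟙-gap-pattern : ∀ v j k → (𝟙 (v ≤? j) * 𝟙 (k <? j)) * 𝟙 (3 + v ≤? punchIn (suc v) (punchIn (suc j) (suc k)))
                            ≡ 𝟙 (v <? k) * 𝟙 (k <? j)
  𝟙-gap-pattern v j k = begin
    (𝟙 (v ≤? j) * 𝟙 (k <? j)) * 𝟙 gap?    ≡⟨ cong (_* 𝟙 gap?) (𝟙-× (v ≤? j) (k <? j)) ⟨
    𝟙 (v ≤? j ×-dec k <? j) * 𝟙 gap?      ≡⟨ 𝟙-× (v ≤? j ×-dec k <? j) gap? ⟨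
    𝟙 ((v ≤? j ×-dec k <? j) ×-dec gap?)  ≡⟨ 𝟙-⇔ ((v ≤? j ×-dec k <? j) ×-dec gap?) (v <? k ×-dec k <? j) to from ⟩
    𝟙 (v <? k ×-dec k <? j)               ≡⟨ 𝟙-× (v <? k) (k <? j) ⟩
    𝟙 (v <? k) * 𝟙 (k <? j)               ∎
    where
    σ₃ : ℕ
    σ₃ = punchIn (suc v) (punchIn (suc j) (suc k))
    gap? : Dec (3 + v ≤ σ₃)
    gap? = 3 + v ≤? σ₃
    σ₃≡ : k < j → σ₃ ≡ punchIn (suc v) (suc k)
    σ₃≡ k<j = cong (punchIn (suc v)) (punchIn-< (suc j) (s≤s k<j))
    to : (v ≤ j × k < j) × 3 + v ≤ σ₃ → v < k × k < j
    to ((_ , k<j) , gap) with suc k <? suc v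
    ... | yes k<v = ⊥-elim (ℕP.<-irrefl refl (ℕP.<-trans (ℕP.n<1+n (suc v)) (ℕP.<-trans gap′ k<v)))
      where
      gap′ : 3 + v ≤ suc k
      gap′ = subst (3 + v ≤_) (trans (σ₃≡ k<j) (punchIn-< (suc v) k<v)) gap
    ... | no k≮v  = ℕP.≤-pred (ℕP.≤-pred gap′) , k<j
      where
      gap′ : 3 + v ≤ 2 + k
      gap′ = subst (3 + v ≤_) (trans (σ₃≡ k<j) (punchIn-≥ (suc v) (ℕP.≮⇒≥ k≮v))) gap
    from : v < k × k < j → (v ≤ j × k < j) × 3 + v ≤ σ₃
    from (v<k , k<j) = (ℕP.<⇒≤ (ℕP.<-trans v<k k<j) , k<j)
                     , subst (3 + v ≤_) (sym (trans (σ₃≡ k<j) (punchIn-≥ (suc v) (s≤s (ℕP.<⇒≤ v<k))))) (s≤s (s≤s v<k))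

  𝟙-altUp-gap2-◁◁◁ : ∀ v j k ρ → 𝟙 (altUp? (v ◁ j ◁ k ◁ ρ)) * 𝟙 (gap2? (v ◁ j ◁ k ◁ ρ))
                                 ≡ (𝟙 (v <? k) * 𝟙 (k <? j)) * 𝟙 (altUp? (k ◁ ρ))
  𝟙-altUp-gap2-◁◁◁ v j k ρ = begin
    𝟙 (altUp? (v ◁ j ◁ k ◁ ρ)) * g                ≡⟨ cong (_* g) (𝟙-altUp-◁◁ v j (k ◁ ρ)) ⟩
    (𝟙 (v ≤? j) * 𝟙 (altDown? (j ◁ k ◁ ρ))) * g  ≡⟨ cong (λ z → (𝟙 (v ≤? j) * z) * g) (𝟙-altDown-◁◁ j k ρ) ⟩
    (𝟙 (v ≤? j) * (𝟙 (k <? j) * u)) * g           ≡⟨ regroup (𝟙 (v ≤? j)) (𝟙 (k <? j)) u g ⟩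
    ((𝟙 (v ≤? j) * 𝟙 (k <? j)) * g) * u           ≡⟨ cong (_* u) (𝟙-gap-pattern v j k) ⟩
    (𝟙 (v <? k) * 𝟙 (k <? j)) * u                 ∎
    where
    regroup : ∀ a b u g → (a * (b * u)) * g ≡ ((a * b) * g) * u
    regroup = solve-∀
    g u : ℕ
    g = 𝟙 (gap2? (v ◁ j ◁ k ◁ ρ))
    u = 𝟙 (altUp? (k ◁ ρ))

  Σ-𝟙-< : ∀ n k → k ≤ n → (Σ[ v < n ] 𝟙 (v <? k)) ≡ k
  Σ-𝟙-< zero    zero    z≤n       = refl
  Σ-𝟙-< (suc n) zero    _         = Σ-0 (suc n) (λ v _ → 𝟙-no (v <? 0) (λ ()))
  Σ-𝟙-< (suc n) (suc k) (s≤s k≤n) =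
    cong suc (trans (Σ-cong n (λ v → 𝟙-⇔ (suc v <? suc k) (v <? k) ℕP.≤-pred s≤s)) (Σ-𝟙-< n k k≤n))

  Σ-𝟙-≤ : ∀ n k → (Σ[ j < n ] 𝟙 (k ≤? j)) ≡ n ∸ k
  Σ-𝟙-≤ zero    k       = sym (ℕP.0∸n≡0 k)
  Σ-𝟙-≤ (suc n) zero    = cong suc (Σ-𝟙-≤ n 0)
  Σ-𝟙-≤ (suc n) (suc k) = trans (Σ-cong n (λ j → 𝟙-⇔ (suc k ≤? suc j) (k ≤? j) ℕP.≤-pred s≤s)) (Σ-𝟙-≤ n k)

  Σ-Σ-*-factor : ∀ n m (A B : ℕ → ℕ) c → (Σ[ v < n ] Σ[ j < m ] (A v * B j) * c) ≡ (Σ< n A * Σ< m B) * c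
  Σ-Σ-*-factor n m A B c = begin
    (Σ[ v < n ] Σ[ j < m ] (A v * B j) * c)  ≡⟨ Σ-cong n inner ⟩
    (Σ[ v < n ] A v * (c * Σ< m B))          ≡⟨ *-distribʳ-Σ n (c * Σ< m B) A ⟨
    Σ< n A * (c * Σ< m B)                    ≡⟨ regroup′ (Σ< n A) c (Σ< m B) ⟩
    (Σ< n A * Σ< m B) * c                    ∎
    where
    regroup : ∀ a b c → (a * b) * c ≡ a * (c * b)
    regroup = solve-∀
    regroup′ : ∀ a c b → a * (c * b) ≡ (a * b) * c
    regroup′ = solve-∀
    inner : ∀ v → (Σ[ j < m ] (A v * B j) * c) ≡ A v * (c * Σ< m B)
    inner v = begin
      (Σ[ j < m ] (A v * B j) * c)  ≡⟨ Σ-cong m (λ j → regroup (A v) (B j) c) ⟩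
      (Σ[ j < m ] A v * (c * B j))  ≡⟨ *-distribˡ-Σ m (A v) (λ j → c * B j) ⟨
      A v * (Σ[ j < m ] c * B j)    ≡⟨ cong (A v *_) (*-distribˡ-Σ m c B) ⟨
      A v * (c * Σ< m B)            ∎

  countAltGap2-by-first-letters : ∀ M → countAltGap2 (3 + M)
    ≡ (Σ[ v < 3 + M ] Σ[ j < 2 + M ] Σ[ k < 1 + M ] (𝟙 (v <? k) * 𝟙 (k <? j)) * startUp M k)
  countAltGap2-by-first-letters M = begin
    countAltGap2 (3 + M)
      ≡⟨ countAltGap2≡sumPerms (3 + M) ⟩
    sumPerms (3 + M) H
      ≡⟨ sumPerms-suc (2 + M) H ⟩
    (Σ[ v < 3 + M ] sumPerms (2 + M) (λ w → H (v ◁ w)))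
      ≡⟨ Σ-cong (3 + M) (λ v → sumPerms-suc (1 + M) (λ w → H (v ◁ w))) ⟩
    (Σ[ v < 3 + M ] Σ[ j < 2 + M ] sumPerms (1 + M) (λ w → H (v ◁ j ◁ w)))
      ≡⟨ Σ-cong (3 + M) (λ v → Σ-cong (2 + M) (λ j → sumPerms-suc M (λ w → H (v ◁ j ◁ w)))) ⟩
    (Σ[ v < 3 + M ] Σ[ j < 2 + M ] Σ[ k < 1 + M ] sumPerms M (λ ρ → H (v ◁ j ◁ k ◁ ρ)))
      ≡⟨ Σ-cong (3 + M) (λ v → Σ-cong (2 + M) (λ j → Σ-cong (1 + M) (λ k →
           trans (sumPerms-cong M (𝟙-altUp-gap2-◁◁◁ v j k)) (sumPerms-*ˡ M (𝟙 (v <? k) * 𝟙 (k <? j)) _)))) ⟩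
    (Σ[ v < 3 + M ] Σ[ j < 2 + M ] Σ[ k < 1 + M ] (𝟙 (v <? k) * 𝟙 (k <? j)) * startUp M k) ∎
    where
    H : List ℕ → ℕ
    H w = 𝟙 (altUp? w) * 𝟙 (gap2? w)

  countAltGap2≡Σ₂ : ∀ M → countAltGap2 (3 + M) ≡ (Σ[ p + q ≡ M ] (p * suc q) * entringer p q)
  countAltGap2≡Σ₂ M = begin
    countAltGap2 (3 + M)
      ≡⟨ countAltGap2-by-first-letters M ⟩
    (Σ[ v < 3 + M ] Σ[ j < 2 + M ] Σ[ k < 1 + M ] F v j k)
      ≡⟨ Σ-cong (3 + M) (λ v → Σ-comm (2 + M) (1 + M) (F v)) ⟩
    (Σ[ v < 3 + M ] Σ[ k < 1 + M ] Σ[ j < 2 + M ] F v j k)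
      ≡⟨ Σ-comm (3 + M) (1 + M) (λ v k → Σ[ j < 2 + M ] F v j k) ⟩
    (Σ[ k < 1 + M ] Σ[ v < 3 + M ] Σ[ j < 2 + M ] F v j k)
      ≡⟨ Σ-cong (1 + M) (λ k → Σ-Σ-*-factor (3 + M) (2 + M) (λ v → 𝟙 (v <? k)) (λ j → 𝟙 (k <? j)) (startUp M k)) ⟩
    (Σ[ k < 1 + M ] ((Σ[ v < 3 + M ] 𝟙 (v <? k)) * (Σ[ j < 2 + M ] 𝟙 (k <? j))) * startUp M k)
      ≡⟨ Σ-cong-< (1 + M) (λ k k<1+M → cong₂ (λ x y → (x * y) * startUp M k)
           (Σ-𝟙-< (3 + M) k (ℕP.≤-trans (ℕP.≤-pred k<1+M) (ℕP.m≤n+m M 3)))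
           (trans (Σ-𝟙-≤ (2 + M) (suc k)) (ℕP.+-∸-assoc 1 (ℕP.≤-pred k<1+M)))) ⟩
    (Σ[ k < 1 + M ] (k * suc (M ∸ k)) * startUp M k)
      ≡⟨ Σ-cong-< (1 + M) (λ k k<1+M →
           cong (λ m → (k * suc (M ∸ k)) * startUp m k) (sym (ℕP.m+[n∸m]≡n (ℕP.≤-pred k<1+M)))) ⟩
    (Σ[ k < 1 + M ] (k * suc (M ∸ k)) * entringer k (M ∸ k))
      ≡⟨ Σ-∸≡Σ₂ M (λ p q → (p * suc q) * entringer p q) ⟩
    (Σ[ p + q ≡ M ] (p * suc q) * entringer p q) ∎
    where
    F : ℕ → ℕ → ℕ → ℕ
    F v j k = (𝟙 (v <? k) * 𝟙 (k <? j)) * startUp M k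

open import Data.Rational using (ℚ; _+_; _*_; _-_)
open Analytic
open Combinatorial using (entringer; entringer-step; entringer-edge; countAltGap2≡Σ₂)
module ℕΣ = FiniteSums ℕP.+-*-isCommutativeSemiring
open ≡-Reasoning

fromℕ-Σ₂ : ∀ n (h : ℕ → ℕ → ℕ) → fromℕ (ℕΣ.Σ₂ n h) ≡ (Σ[ p + q ≡ n ] fromℕ (h p q))
fromℕ-Σ₂ zero    h = refl
fromℕ-Σ₂ (suc n) h =
  trans (fromℕ-homo-+ (h 0 (suc n)) _) (cong (fromℕ (h 0 (suc n)) +_) (fromℕ-Σ₂ n (λ p q → h (suc p) q)))

entringer-isBoustrophedon : IsBoustrophedon (λ p q → fromℕ (entringer p q))
entringer-isBoustrophedon = record
  { step = λ p q → trans (cong fromℕ (entringer-step p q)) (fromℕ-homo-+ (entringer (suc p) q) (entringer q p))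
  ; edge = λ p → cong fromℕ (entringer-edge p)
  }

mainTheorem5 : (n : ℕ) → 3 ≤ n → fromℕ (countAltGap2 n) ≡ fromℕ (n !) * targetS n
mainTheorem5 (suc (suc (suc M))) (s≤s (s≤s (s≤s z≤n))) = begin
  fromℕ (countAltGap2 (3 ℕ.+ M))
    ≡⟨ cong fromℕ (countAltGap2≡Σ₂ M) ⟩
  fromℕ (ℕΣ.Σ₂ M (λ p q → (p ℕ.* suc q) ℕ.* entringer p q))
    ≡⟨ fromℕ-Σ₂ M (λ p q → (p ℕ.* suc q) ℕ.* entringer p q) ⟩
  (Σ[ p + q ≡ M ] fromℕ ((p ℕ.* suc q) ℕ.* entringer p q))
    ≡⟨ Σ₂-cong M (λ p q → fromℕ-homo-* (p ℕ.* suc q) (entringer p q)) ⟩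
  (Σ[ p + q ≡ M ] fromℕ (p ℕ.* suc q) * E p q)
    ≡⟨ weighted-antidiagonal-sum entringer-isBoustrophedon M ⟩
  fromℕ 2 * E 0 (3 ℕ.+ M) - fromℕ (4 ℕ.+ M) * E 0 (2 ℕ.+ M)
    ≡⟨ cong₂ (λ a b → fromℕ 2 * a - fromℕ (4 ℕ.+ M) * b) (E₀≡zigzag (3 ℕ.+ M)) (E₀≡zigzag (2 ℕ.+ M)) ⟩
  fromℕ 2 * zigzag (3 ℕ.+ M) - fromℕ (4 ℕ.+ M) * zigzag (2 ℕ.+ M)
    ≡⟨ targetS-coeff (2 ℕ.+ M) ⟨
  fromℕ ((3 ℕ.+ M) !) * targetS (3 ℕ.+ M) ∎
  where
  E : ℕ → ℕ → ℚ
  E p q = fromℕ (entringer p q)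
  zigzag : ℕ → ℚ
  zigzag n = fromℕ (n !) * (secS ⊕ tanS) n
  E₀≡zigzag : ∀ n → E 0 n ≡ zigzag n
  E₀≡zigzag n = trans (boustrophedon-unique entringer-isBoustrophedon entringerSeries-isBoustrophedon refl 0 n)
                      (entringerSeries-zero n)
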